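{- Let $s\ge1$, $0\le p\le r\le k$ and $n\ge sk$ be integers. Then \[ L^{(s)}_r(n,k)=\sum_{i=0}^{p}\sum_{j=i}^{n-sk}\frac{(n-r)!}{(n-r-j-(s-1)p)!}\binom{p}{i}\binom{p+j-1}{j-i}L^{(s)}_{r-p}(n-sp-j,\,k-p)\,s^{p-i}. \]
   Context: Fix an integer $s\ge1$. For integers $n,k,r\ge0$, $L^{(s)}_r(n,k)$ is the number of partitions of $\{1,\dots,n\}$ into exactly $k$ ordered lists (nonempty blocks each with a linear order, the set of blocks unordered) such that $1,\dots,r$ lie in pairwise distinct lists and every list has at least $s$ elements. Binomial coefficients are $\binom{m}{j}=m(m-1)\cdots(m-j+1)/j!$ for integers $m$ and $j\ge0$ (so $\binom{ -1}{0}=1$), and $0$ for $j<0$. -}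

module Defs where

open import Data.Nat using (ℕ; zero; suc; _+_; _*_; _∸_; _≤_; _<_; _⊓_; _≤?_; _<?_)
open import Data.Fin using (Fin; toℕ)
import Data.Fin.Properties as FinP
open import Data.List using (List; []; _∷_; [_]; map; concat; concatMap; length; filter; foldr; upTo; allFin)
open import Data.Nat.ListAction using (sum)
open import Data.List.Relation.Unary.All using (All; all?)
open import Data.List.Relation.Unary.AllPairs using (AllPairs; allPairs?)
open import Data.Product using (_×_)
open import Relation.Binary.PropositionalEquality using (_≡_)
open import Relation.Nullary.Decidable using (Dec; _×-dec_)
import Data.Nat.Properties as NatP

-- Finite sum  Σ_{i=a}^{b} f i  (empty, i.e. 0, when b < a).
sumFromTo : ℕ → ℕ → (ℕ → ℕ) → ℕ
sumFromTo a b f = sum (map (λ i → f (a + i)) (upTo (suc b ∸ a)))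

-- The ground set {1,…,n} is  Fin n  (element i+1 is represented by the
-- Fin-index i, so "the elements 1,…,r" are the x with toℕ x < r).
-- A partition into k ordered lists is represented by a list  bs  of k
-- lists (the blocks, each list carrying its linear order).  Since the set
-- of blocks is unordered, we fix the canonical representative in which the
-- blocks are listed by strictly increasing minimal element.

-- minimal element of a block (as a natural number); for nonempty blocks
-- this is the minimum, the start value n is an upper bound of Fin n.
blockMin : {n : ℕ} → List (Fin n) → ℕ
blockMin {n} b = foldr _⊓_ n (map toℕ b)

occ : {n : ℕ} → Fin n → List (Fin n) → ℕ
occ x xs = length (filter (x FinP.≟_) xs)

numSmall : {n : ℕ} → ℕ → List (Fin n) → ℕ
numSmall r b = length (filter (λ x → toℕ x <? r) b)

IsOLP : (s r n k : ℕ) → List (List (Fin n)) → Set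
IsOLP s r n k bs =
    (length bs ≡ k)
  × ((x : Fin n) → occ x (concat bs) ≡ 1)
  × All (λ b → s ≤ length b) bs
  × All (λ b → numSmall r b ≤ 1) bs
  × AllPairs (λ b b' → blockMin b < blockMin b') bs

isOLP? : (s r n k : ℕ) → (bs : List (List (Fin n))) → Dec (IsOLP s r n k bs)
isOLP? s r n k bs =
      (length bs NatP.≟ k)
  ×-dec FinP.all? (λ x → occ x (concat bs) NatP.≟ 1)
  ×-dec all? (λ b → s ≤? length b) bs
  ×-dec all? (λ b → numSmall r b ≤? 1) bs
  ×-dec allPairs? (λ b b' → blockMin b <? blockMin b') bs

words : {A : Set} → List A → ℕ → List (List A)
words xs zero    = [ [] ]
words xs (suc m) = concatMap (λ x → map (x ∷_) (words xs m)) xs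

wordLists : {A : Set} → List A → ℕ → ℕ → List (List (List A))
wordLists xs zero    zero    = [ [] ]
wordLists xs (suc t) zero    = []
wordLists xs t       (suc c) =
  concatMap (λ m → concatMap (λ w → map (w ∷_) (wordLists xs (t ∸ m) c))
                             (words xs m))
            (upTo (suc t))

-- Every such object is a list of k words over
-- Fin n of total length n, and these candidates are enumerated without
-- repetition, so we count by filtering the candidates.
L : (s r n k : ℕ) → ℕ
L s r n k = length (filter (isOLP? s r n k) (wordLists (allFin n) n k))

module Submission where

open import Defs
open import Data.Nat using (ℕ; _+_; _*_; _∸_; _^_; _≤_; _/_; _!)
open import Data.Nat.Properties using (_!≢0)
open import Data.Nat.Combinatorics using (_C_)
open import Relation.Binary.PropositionalEquality using (_≡_)

-- List the blocks by increasing minima.  The first block contains the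
-- minimum g₀ of the ground set, and g₀ is small (one of 1, …, r) unless no
-- element is small; so a first block of size m ≥ s consists of g₀ at one of
-- m places and m-1 distinct non-small elements.  This yields a closed
-- recursion Φ s t σ k for the number of partitions of a t-element set with σ
-- small elements (Recurrence), and L s r n k = Φ s n (min r n) k
-- (FinTransfer).  Unrolling Φ through the first p blocks, of sizes s + jᵢ
-- (Unrolling), the fillings multiply to one falling factorial
-- FF (n-r) (j + (s-1)p) with j = Σ jᵢ, while the weights Π (s + jᵢ) add up to
-- A p j = [x^j] (s/(1-x) + x/(1-x)²)^p, whose binomial expansion is
-- Σ_i C(p,i) s^(p-i) C(p+j-1, j-i) (Binomial).  Writing the factorial
-- quotient as FF and exchanging the two sums gives the theorem (Assembly).

-- Counting the entries of a list that satisfy a decidable predicate.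
module Counting where

  open import Data.Nat using (ℕ; suc; _+_; _*_; _<_; _≤_; z≤n; s≤s)
  open import Data.Nat.Properties
  open import Data.List using (List; []; _∷_; _++_; map; concatMap; length; filter)
  open import Data.List.Properties using (filter-++; length-++; map-∘; map-++)
  open import Data.Nat.ListAction using (sum)
  open import Data.Nat.ListAction.Properties using (sum-++)
  open import Data.List.Membership.Propositional using (_∈_)
  open import Data.List.Relation.Unary.Any using (here; there)
  open import Data.List.Relation.Unary.All using (lookup)
  open import Data.List.Relation.Unary.Unique.Propositional using (Unique)
  open import Data.List.Relation.Unary.AllPairs using (_∷_)
  open import Data.Bool using (if_then_else_)
  open import Relation.Nullary using (yes; no; does; ¬_; ¬?)
  open import Relation.Nullary.Decidable using (_×-dec_)
  open import Relation.Unary using (Pred; Decidable)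
  open import Relation.Binary.PropositionalEquality
  open import Data.Product using (_×_; _,_; ∃)
  open import Data.Empty using (⊥-elim)
  open import Function using (_∘_)
  open import Level using (0ℓ)

  _∧?_ : ∀ {A : Set} {P Q : Pred A 0ℓ} → Decidable P → Decidable Q → Decidable (λ x → P x × Q x)
  (P? ∧? Q?) x = P? x ×-dec Q? x

  module _ {A : Set} where

    cnt : {P : Pred A 0ℓ} → Decidable P → List A → ℕ
    cnt P? xs = length (filter P? xs)

    ind : {P : Pred A 0ℓ} → Decidable P → A → ℕ
    ind P? x = if does (P? x) then 1 else 0

    ind-yes : {P : Pred A 0ℓ} (P? : Decidable P) {x : A} → P x → ind P? x ≡ 1
    ind-yes P? {x} p with P? x
    ... | yes _ = refl
    ... | no ¬p = ⊥-elim (¬p p)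

    ind-no : {P : Pred A 0ℓ} (P? : Decidable P) {x : A} → ¬ P x → ind P? x ≡ 0
    ind-no P? {x} ¬p with P? x
    ... | yes p = ⊥-elim (¬p p)
    ... | no _ = refl

    cnt-∷ : {P : Pred A 0ℓ} (P? : Decidable P) (x : A) (xs : List A) →
      cnt P? (x ∷ xs) ≡ ind P? x + cnt P? xs
    cnt-∷ P? x xs with P? x
    ... | yes _ = refl
    ... | no _ = refl

    cnt-++ : {P : Pred A 0ℓ} (P? : Decidable P) (xs ys : List A) →
      cnt P? (xs ++ ys) ≡ cnt P? xs + cnt P? ys
    cnt-++ P? xs ys = trans (cong length (filter-++ P? xs ys)) (length-++ (filter P? xs))

    cnt-cong : {P Q : Pred A 0ℓ} (P? : Decidable P) (Q? : Decidable Q) (xs : List A) →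
      (∀ x → x ∈ xs → P x → Q x) → (∀ x → x ∈ xs → Q x → P x) → cnt P? xs ≡ cnt Q? xs
    cnt-cong P? Q? [] f g = refl
    cnt-cong P? Q? (x ∷ xs) f g
      rewrite cnt-∷ P? x xs | cnt-∷ Q? x xs
            | cnt-cong P? Q? xs (λ y y∈ → f y (there y∈)) (λ y y∈ → g y (there y∈))
      with P? x | Q? x
    ... | yes _ | yes _ = refl
    ... | no _ | no _ = refl
    ... | yes p | no ¬q = ⊥-elim (¬q (f x (here refl) p))
    ... | no ¬p | yes q = ⊥-elim (¬p (g x (here refl) q))

    cnt-mono : {P Q : Pred A 0ℓ} (P? : Decidable P) (Q? : Decidable Q) (xs : List A) →
      (∀ x → x ∈ xs → P x → Q x) → cnt P? xs ≤ cnt Q? xs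
    cnt-mono P? Q? [] f = z≤n
    cnt-mono P? Q? (x ∷ xs) f rewrite cnt-∷ P? x xs | cnt-∷ Q? x xs with P? x | Q? x
    ... | yes _ | yes _ = s≤s (cnt-mono P? Q? xs (λ y y∈ → f y (there y∈)))
    ... | no _ | yes _ = m≤n⇒m≤1+n (cnt-mono P? Q? xs (λ y y∈ → f y (there y∈)))
    ... | no _ | no _ = cnt-mono P? Q? xs (λ y y∈ → f y (there y∈))
    ... | yes p | no ¬q = ⊥-elim (¬q (f x (here refl) p))

    cnt-zero : {P : Pred A 0ℓ} (P? : Decidable P) (xs : List A) →
      (∀ x → x ∈ xs → ¬ P x) → cnt P? xs ≡ 0
    cnt-zero P? [] f = refl
    cnt-zero P? (x ∷ xs) f with P? x
    ... | yes p = ⊥-elim (f x (here refl) p)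
    ... | no _ = cnt-zero P? xs (λ y y∈ → f y (there y∈))

    cnt-compl : {P : Pred A 0ℓ} (P? : Decidable P) (xs : List A) →
      cnt P? xs + cnt (¬? ∘ P?) xs ≡ length xs
    cnt-compl P? [] = refl
    cnt-compl P? (x ∷ xs) with P? x
    ... | yes _ = cong suc (cnt-compl P? xs)
    ... | no _ = trans (+-suc _ _) (cong suc (cnt-compl P? xs))

    cnt-all : {P : Pred A 0ℓ} (P? : Decidable P) (xs : List A) →
      (∀ x → x ∈ xs → P x) → cnt P? xs ≡ length xs
    cnt-all P? xs h = begin
        cnt P? xs                              ≡⟨ sym (+-identityʳ _) ⟩
        cnt P? xs + 0                          ≡⟨ cong (cnt P? xs +_) (sym (cnt-zero (¬? ∘ P?) xs (λ x x∈ ¬p → ¬p (h x x∈)))) ⟩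
        cnt P? xs + cnt (¬? ∘ P?) xs           ≡⟨ cnt-compl P? xs ⟩
        length xs                              ∎
      where open ≡-Reasoning

    cnt-split : {P Q : Pred A 0ℓ} (P? : Decidable P) (Q? : Decidable Q) (xs : List A) →
      cnt P? xs ≡ cnt (P? ∧? Q?) xs + cnt (P? ∧? (¬? ∘ Q?)) xs
    cnt-split P? Q? [] = refl
    cnt-split P? Q? (x ∷ xs)
      rewrite cnt-∷ P? x xs | cnt-∷ (P? ∧? Q?) x xs | cnt-∷ (P? ∧? (¬? ∘ Q?)) x xs | cnt-split P? Q? xs
      with P? x | Q? x
    ... | yes _ | yes _ = refl
    ... | yes _ | no _ = sym (+-suc _ _)
    ... | no _ | yes _ = refl
    ... | no _ | no _ = refl

    cnt-of-filter : {P Q : Pred A 0ℓ} (P? : Decidable P) (Q? : Decidable Q) (xs : List A) →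
      cnt P? (filter Q? xs) ≡ cnt (P? ∧? Q?) xs
    cnt-of-filter P? Q? [] = refl
    cnt-of-filter P? Q? (x ∷ xs) with Q? x
    ... | yes _ with P? x
    ...   | yes _ = cong suc (cnt-of-filter P? Q? xs)
    ...   | no _ = cnt-of-filter P? Q? xs
    cnt-of-filter P? Q? (x ∷ xs) | no _ with P? x
    ...   | yes _ = cnt-of-filter P? Q? xs
    ...   | no _ = cnt-of-filter P? Q? xs

    cnt-witness : {P : Pred A 0ℓ} (P? : Decidable P) (xs : List A) →
      0 < cnt P? xs → ∃ λ x → x ∈ xs × P x
    cnt-witness P? (x ∷ xs) h with P? x
    ... | yes p = x , here refl , p
    ... | no _ with cnt-witness P? xs h
    ...   | y , y∈ , p = y , there y∈ , p

    cnt-∈ : {P : Pred A 0ℓ} (P? : Decidable P) {xs : List A} {x : A} → x ∈ xs → P x → 1 ≤ cnt P? xs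
    cnt-∈ P? {y ∷ ys} (here refl) p with P? y
    ... | yes _ = s≤s z≤n
    ... | no ¬p = ⊥-elim (¬p p)
    cnt-∈ P? {y ∷ ys} (there i) p with P? y
    ... | yes _ = s≤s z≤n
    ... | no _ = cnt-∈ P? i p

    cnt-two : {P : Pred A 0ℓ} (P? : Decidable P) (xs : List A) {x y : A} →
      x ∈ xs → y ∈ xs → ¬ x ≡ y → P x → P y → 2 ≤ cnt P? xs
    cnt-two P? (z ∷ xs) (here refl) (here refl) x≢y px py = ⊥-elim (x≢y refl)
    cnt-two P? (z ∷ xs) (here refl) (there y∈) x≢y px py with P? z
    ... | yes _ = s≤s (cnt-∈ P? y∈ py)
    ... | no ¬p = ⊥-elim (¬p px)
    cnt-two P? (z ∷ xs) (there x∈) (here refl) x≢y px py =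
      cnt-two P? (z ∷ xs) (here refl) (there x∈) (x≢y ∘ sym) py px
    cnt-two P? (z ∷ xs) (there x∈) (there y∈) x≢y px py with P? z
    ... | yes _ = m≤n⇒m≤1+n (cnt-two P? xs x∈ y∈ x≢y px py)
    ... | no _ = cnt-two P? xs x∈ y∈ x≢y px py

    cnt-unique : {P : Pred A 0ℓ} (P? : Decidable P) (xs : List A) → Unique xs →
      (∀ x y → P x → P y → x ≡ y) → cnt P? xs ≤ 1
    cnt-unique P? [] u f = z≤n
    cnt-unique P? (x ∷ xs) (x∉ ∷ u) f with P? x
    ... | no _ = cnt-unique P? xs u f
    ... | yes px = s≤s (≤-reflexive (cnt-zero P? xs (λ y y∈ py → lookup x∉ y∈ (f x y px py))))

    sum-cong : (f g : A → ℕ) (xs : List A) → (∀ x → x ∈ xs → f x ≡ g x) →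
      sum (map f xs) ≡ sum (map g xs)
    sum-cong f g [] h = refl
    sum-cong f g (x ∷ xs) h = cong₂ _+_ (h x (here refl)) (sum-cong f g xs (λ y y∈ → h y (there y∈)))

    sum-zero : (f : A → ℕ) (xs : List A) → (∀ x → f x ≡ 0) → sum (map f xs) ≡ 0
    sum-zero f [] h = refl
    sum-zero f (x ∷ xs) h rewrite h x = sum-zero f xs h

    sum-ind : {P : Pred A 0ℓ} (P? : Decidable P) (c : ℕ) (xs : List A) →
      sum (map (λ x → ind P? x * c) xs) ≡ cnt P? xs * c
    sum-ind P? c [] = refl
    sum-ind P? c (x ∷ xs) rewrite cnt-∷ P? x xs | sum-ind P? c xs = sym (*-distribʳ-+ c (ind P? x) _)

    sum-filter : {Q : Pred A 0ℓ} (Q? : Decidable Q) (f : A → ℕ) (xs : List A) →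
      (∀ x → ¬ Q x → f x ≡ 0) → sum (map f xs) ≡ sum (map f (filter Q? xs))
    sum-filter Q? f [] h = refl
    sum-filter Q? f (x ∷ xs) h with Q? x
    ... | yes _ = cong (f x +_) (sum-filter Q? f xs h)
    ... | no ¬q rewrite h x ¬q = sum-filter Q? f xs h

  module _ {A B : Set} where

    cnt-map : {P : Pred B 0ℓ} (P? : Decidable P) (f : A → B) (xs : List A) →
      cnt P? (map f xs) ≡ cnt (P? ∘ f) xs
    cnt-map P? f [] = refl
    cnt-map P? f (x ∷ xs) rewrite cnt-∷ P? (f x) (map f xs) | cnt-∷ (P? ∘ f) x xs | cnt-map P? f xs = refl

    cnt-concatMap : {P : Pred B 0ℓ} (P? : Decidable P) (f : A → List B) (xs : List A) →
      cnt P? (concatMap f xs) ≡ sum (map (λ x → cnt P? (f x)) xs)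
    cnt-concatMap P? f [] = refl
    cnt-concatMap P? f (x ∷ xs) rewrite cnt-++ P? (f x) (concatMap f xs) | cnt-concatMap P? f xs = refl

    sum-concatMap : (F : B → ℕ) (g : A → List B) (xs : List A) →
      sum (map F (concatMap g xs)) ≡ sum (map (λ x → sum (map F (g x))) xs)
    sum-concatMap F g [] = refl
    sum-concatMap F g (x ∷ xs)
      rewrite map-++ F (g x) (concatMap g xs) | sum-++ (map F (g x)) (map F (concatMap g xs))
            | sum-concatMap F g xs = refl

    sum-map : (F : B → ℕ) (h : A → B) (xs : List A) → sum (map F (map h xs)) ≡ sum (map (F ∘ h) xs)
    sum-map F h xs = cong sum (sym (map-∘ xs))

module Words where

  open import Data.Nat using (ℕ; zero; suc; _∸_; _<_; z≤n)
  open import Data.Nat.Properties using (≤-antisym; ≮⇒≥)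
  open import Data.List using (List; []; _∷_; map; concatMap; length; filter; upTo)
  open import Data.List.Properties using (map-∘; concatMap-map; map-concatMap; concatMap-cong)
  open import Data.Nat.ListAction using (sum)
  open import Data.List.Membership.Propositional using (_∈_)
  open import Data.List.Relation.Unary.Any using (here; there)
  open import Data.List.Relation.Unary.All as All using (All; []; _∷_)
  import Data.List.Relation.Unary.All.Properties as AllP
  open import Relation.Nullary using (¬_)
  open import Relation.Unary using (Pred; Decidable)
  open import Relation.Binary.PropositionalEquality
  open import Data.Product using (_×_; _,_; proj₂)
  open import Function using (_∘_)
  open import Level using (0ℓ)
  open import Defs using (words; wordLists)
  open Counting

  -- The defining equation of wordLists for a positive number of words, for
  -- an arbitrary (possibly non-literal) total length t.
  wordLists-suc : {A : Set} (xs : List A) (t c : ℕ) → wordLists xs t (suc c) ≡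
    concatMap (λ m → concatMap (λ w → map (w ∷_) (wordLists xs (t ∸ m) c)) (words xs m)) (upTo (suc t))
  wordLists-suc xs zero c = refl
  wordLists-suc xs (suc t) c = refl

  All-concatMap : {A B : Set} {P : Pred B 0ℓ} (f : A → List B) (xs : List A) →
    (∀ x → x ∈ xs → All P (f x)) → All P (concatMap f xs)
  All-concatMap f [] h = []
  All-concatMap f (x ∷ xs) h = AllP.++⁺ (h x (here refl)) (All-concatMap f xs (λ y y∈ → h y (there y∈)))

  module _ {A : Set} (xs : List A) where

    words-shape : (m : ℕ) → All (λ w → length w ≡ m × All (_∈ xs) w) (words xs m)
    words-shape zero = (refl , []) ∷ []
    words-shape (suc m) = All-concatMap _ xs (λ x x∈ →
      AllP.map⁺ (All.map (λ (len , inxs) → cong suc len , x∈ ∷ inxs) (words-shape m)))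

    wordLists-shape : (t c : ℕ) → All (λ bs → length bs ≡ c × All (All (_∈ xs)) bs) (wordLists xs t c)
    wordLists-shape zero zero = (refl , []) ∷ []
    wordLists-shape (suc t) zero = []
    wordLists-shape t (suc c) rewrite wordLists-suc xs t c =
      All-concatMap _ (upTo (suc t)) (λ m _ → All-concatMap _ (words xs m) (λ w w∈ →
        AllP.map⁺ (All.map (λ (len , inxs) → cong suc len , proj₂ (All.lookup (words-shape m) w∈) ∷ inxs)
                           (wordLists-shape (t ∸ m) c))))

    sum-words-filter : {Q : Pred A 0ℓ} (Q? : Decidable Q) (m : ℕ) (F : List A → ℕ) →
      (∀ w → 0 < F w → All Q w) → sum (map F (words xs m)) ≡ sum (map F (words (filter Q? xs) m))
    sum-words-filter Q? zero F h = refl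
    sum-words-filter {Q} Q? (suc m) F h
      rewrite sum-concatMap F (λ x → map (x ∷_) (words xs m)) xs
            | sum-concatMap F (λ x → map (x ∷_) (words (filter Q? xs) m)) (filter Q? xs) =
      trans (sum-filter Q? _ xs firstLetterOutside) (sum-cong _ _ (filter Q? xs) (λ x _ →
        trans (sum-map F (x ∷_) (words xs m))
          (trans (sum-words-filter Q? m (F ∘ (x ∷_)) (λ w pos → All.tail (h (x ∷ w) pos)))
            (sym (sum-map F (x ∷_) (words (filter Q? xs) m))))))
      where
      firstLetterOutside : ∀ x → ¬ Q x → sum (map F (map (x ∷_) (words xs m))) ≡ 0
      firstLetterOutside x ¬q = trans (sum-map F (x ∷_) (words xs m))
        (sum-zero (F ∘ (x ∷_)) (words xs m) (λ w → ≤-antisym (≮⇒≥ (¬q ∘ All.head ∘ h (x ∷ w))) z≤n))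

    cnt-wordLists-filter : {Q : Pred A 0ℓ} (Q? : Decidable Q) (c : ℕ)
      {P : Pred (List (List A)) 0ℓ} (P? : Decidable P) → (∀ bs → P bs → All (All Q) bs) →
      (t : ℕ) → cnt P? (wordLists xs t c) ≡ cnt P? (wordLists (filter Q? xs) t c)
    cnt-wordLists-filter Q? zero P? h zero = refl
    cnt-wordLists-filter Q? zero P? h (suc t) = refl
    cnt-wordLists-filter {Q} Q? (suc c) P? h t
      rewrite wordLists-suc xs t c | wordLists-suc (filter Q? xs) t c
            | cnt-concatMap P? (λ m → concatMap (λ w → map (w ∷_) (wordLists xs (t ∸ m) c)) (words xs m)) (upTo (suc t))
            | cnt-concatMap P? (λ m → concatMap (λ w → map (w ∷_) (wordLists (filter Q? xs) (t ∸ m) c))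
                                                 (words (filter Q? xs) m)) (upTo (suc t)) =
      sum-cong _ _ (upTo (suc t)) (λ m _ → begin
        cnt P? (blocks xs m)
          ≡⟨ cnt-concatMap P? (λ w → map (w ∷_) (wordLists xs (t ∸ m) c)) (words xs m) ⟩
        sum (map (λ w → cnt P? (map (w ∷_) (wordLists xs (t ∸ m) c))) (words xs m))
          ≡⟨ sum-cong _ _ (words xs m) (λ w _ → restWords m w) ⟩
        sum (map (λ w → rest m w) (words xs m))
          ≡⟨ sum-words-filter Q? m (rest m) (firstWord m) ⟩
        sum (map (λ w → rest m w) (words (filter Q? xs) m))
          ≡⟨ sym (sum-cong _ _ (words (filter Q? xs) m) (λ w _ → cnt-map P? (w ∷_) (wordLists (filter Q? xs) (t ∸ m) c))) ⟩
        sum (map (λ w → cnt P? (map (w ∷_) (wordLists (filter Q? xs) (t ∸ m) c))) (words (filter Q? xs) m))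
          ≡⟨ sym (cnt-concatMap P? (λ w → map (w ∷_) (wordLists (filter Q? xs) (t ∸ m) c)) (words (filter Q? xs) m)) ⟩
        cnt P? (blocks (filter Q? xs) m) ∎)
      where
      open ≡-Reasoning
      blocks : List A → ℕ → List (List (List A))
      blocks ys m = concatMap (λ w → map (w ∷_) (wordLists ys (t ∸ m) c)) (words ys m)
      rest : ℕ → List A → ℕ
      rest m w = cnt (P? ∘ (w ∷_)) (wordLists (filter Q? xs) (t ∸ m) c)
      restWords : ∀ m w → cnt P? (map (w ∷_) (wordLists xs (t ∸ m) c)) ≡ rest m w
      restWords m w = trans (cnt-map P? (w ∷_) (wordLists xs (t ∸ m) c))
        (cnt-wordLists-filter Q? c (P? ∘ (w ∷_)) (λ bs p → All.tail (h (w ∷ bs) p)) (t ∸ m))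
      firstWord : ∀ m w → 0 < rest m w → All Q w
      firstWord m w pos with cnt-witness (P? ∘ (w ∷_)) (wordLists (filter Q? xs) (t ∸ m) c) pos
      ... | bs , _ , p = All.head (h (w ∷ bs) p)

  module _ {A B : Set} (f : A → B) where

    words-map : (xs : List A) (m : ℕ) → words (map f xs) m ≡ map (map f) (words xs m)
    words-map xs zero = refl
    words-map xs (suc m) = begin
        concatMap (λ y → map (y ∷_) (words (map f xs) m)) (map f xs)
      ≡⟨ concatMap-map _ f xs ⟩
        concatMap (λ x → map (f x ∷_) (words (map f xs) m)) xs
      ≡⟨ concatMap-cong (λ x → trans (cong (map (f x ∷_)) (words-map xs m))
                                     (trans (sym (map-∘ (words xs m))) (map-∘ (words xs m)))) xs ⟩
        concatMap (λ x → map (map f) (map (x ∷_) (words xs m))) xs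
      ≡⟨ sym (map-concatMap (map f) _ xs) ⟩
        map (map f) (concatMap (λ x → map (x ∷_) (words xs m)) xs) ∎
      where open ≡-Reasoning

    wordLists-map : (xs : List A) (t c : ℕ) → wordLists (map f xs) t c ≡ map (map (map f)) (wordLists xs t c)
    wordLists-map xs zero zero = refl
    wordLists-map xs (suc t) zero = refl
    wordLists-map xs t (suc c) rewrite wordLists-suc (map f xs) t c | wordLists-suc xs t c = begin
        concatMap (blocks (map f xs)) (upTo (suc t))
      ≡⟨ concatMap-cong blocks-map (upTo (suc t)) ⟩
        concatMap (map (map (map f)) ∘ blocks xs) (upTo (suc t))
      ≡⟨ sym (map-concatMap (map (map f)) _ (upTo (suc t))) ⟩
        map (map (map f)) (concatMap (blocks xs) (upTo (suc t))) ∎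
      where
      open ≡-Reasoning
      blocks : {C : Set} → List C → ℕ → List (List (List C))
      blocks ys m = concatMap (λ w → map (w ∷_) (wordLists ys (t ∸ m) c)) (words ys m)
      blocks-map : ∀ m → blocks (map f xs) m ≡ map (map (map f)) (blocks xs m)
      blocks-map m = begin
          concatMap (λ w → map (w ∷_) (wordLists (map f xs) (t ∸ m) c)) (words (map f xs) m)
        ≡⟨ cong (concatMap _) (words-map xs m) ⟩
          concatMap (λ w → map (w ∷_) (wordLists (map f xs) (t ∸ m) c)) (map (map f) (words xs m))
        ≡⟨ concatMap-map _ (map f) (words xs m) ⟩
          concatMap (λ w → map (map f w ∷_) (wordLists (map f xs) (t ∸ m) c)) (words xs m)
        ≡⟨ concatMap-cong (λ w → trans (cong (map (map f w ∷_)) (wordLists-map xs (t ∸ m) c))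
              (trans (sym (map-∘ (wordLists xs (t ∸ m) c))) (map-∘ (wordLists xs (t ∸ m) c)))) (words xs m) ⟩
          concatMap (λ w → map (map (map f)) (map (w ∷_) (wordLists xs (t ∸ m) c))) (words xs m)
        ≡⟨ sym (map-concatMap (map (map f)) _ (words xs m)) ⟩
          map (map (map f)) (blocks xs m) ∎

-- Partitions of a sorted ground set g ⊆ ℕ into ordered lists, and the
-- decomposition of a partition into its first block and a partition of the rest.
module Blocks where

  open import Data.Nat using (ℕ; suc; _+_; _*_; _∸_; _<_; _≤_; s≤s; _⊓_; _≟_; _≤?_; _<?_)
  open import Data.Nat.Properties
  open import Data.List using (List; []; _∷_; _++_; map; concat; length; filter)
  open import Data.List.Membership.Propositional using (_∈_; _∉_)
  open import Data.List.Membership.Propositional.Properties using (∈-filter⁻; ∈-filter⁺; ∈-concat⁻′; ∈-concat⁺′)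
  open import Data.List.Membership.DecPropositional _≟_ using (_∈?_)
  open import Data.List.Relation.Unary.Any using (here; there)
  open import Data.List.Relation.Unary.All as All using (All; []; _∷_; all?)
  open import Data.List.Relation.Unary.AllPairs as AP using (AllPairs; []; _∷_; allPairs?)
  import Data.List.Relation.Unary.AllPairs.Properties as APP
  open import Data.List.Relation.Unary.Unique.DecPropositional _≟_ using (Unique; unique?)
  open import Relation.Nullary using (yes; no; ¬_; ¬?)
  open import Relation.Nullary.Decidable using (_×-dec_)
  open import Relation.Unary using (Decidable)
  open import Relation.Binary.PropositionalEquality
  open import Data.Product using (_×_; _,_; proj₁; proj₂)
  open import Data.Sum using (inj₁; inj₂)
  open import Data.Empty using (⊥-elim)
  open import Function using (_∘_)
  open import Defs using (wordLists)
  open Counting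
  open Words

  occN : ℕ → List ℕ → ℕ
  occN x xs = cnt (x ≟_) xs

  small : ℕ → List ℕ → ℕ
  small r b = cnt (_<? r) b

  minimum : List ℕ → ℕ
  minimum [] = 0
  minimum (x ∷ []) = x
  minimum (x ∷ y ∷ l) = x ⊓ minimum (y ∷ l)

  minimum-∈ : ∀ x l → minimum (x ∷ l) ∈ x ∷ l
  minimum-∈ x [] = here refl
  minimum-∈ x (y ∷ l) with ⊓-sel x (minimum (y ∷ l))
  ... | inj₁ e = here e
  ... | inj₂ e = there (subst (_∈ y ∷ l) (sym e) (minimum-∈ y l))

  minimum-≤ : ∀ {x l} → x ∈ l → minimum l ≤ x
  minimum-≤ {l = y ∷ []} (here refl) = ≤-refl
  minimum-≤ {l = y ∷ z ∷ l} (here refl) = m⊓n≤m y _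
  minimum-≤ {l = y ∷ z ∷ l} (there i) = ≤-trans (m⊓n≤n y _) (minimum-≤ i)

  -- For g = [0 … n-1] this is IsOLP of Defs (see FinTransfer).
  Partition : ℕ → ℕ → List ℕ → ℕ → List (List ℕ) → Set
  Partition s r g k bs =
      (length bs ≡ k)
    × All (λ x → occN x (concat bs) ≡ 1) g
    × All (λ b → s ≤ length b) bs
    × All (λ b → small r b ≤ 1) bs
    × AllPairs (λ b b' → minimum b < minimum b') bs

  partition? : ∀ s r g k → Decidable (Partition s r g k)
  partition? s r g k bs =
          (length bs ≟ k)
    ×-dec all? (λ x → occN x (concat bs) ≟ 1) g
    ×-dec all? (λ b → s ≤? length b) bs
    ×-dec all? (λ b → small r b ≤? 1) bs
    ×-dec allPairs? (λ b b' → minimum b <? minimum b') bs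

  G : ℕ → ℕ → List ℕ → ℕ → ℕ
  G s r g k = cnt (partition? s r g k) (wordLists g (length g) k)

  occ-unique : ∀ {x l} → Unique l → x ∈ l → occN x l ≡ 1
  occ-unique {x} {l} u x∈ = ≤-antisym (cnt-unique (x ≟_) l u (λ a b e₁ e₂ → trans (sym e₁) e₂)) (cnt-∈ (x ≟_) x∈ refl)

  occ-∉ : ∀ {x l} → x ∉ l → occN x l ≡ 0
  occ-∉ {x} {l} x∉ = cnt-zero (x ≟_) l (λ y y∈ e → x∉ (subst (_∈ l) (sym e) y∈))

  occ-∈ : ∀ {x l} → 1 ≤ occN x l → x ∈ l
  occ-∈ {x} {l} h with cnt-witness (x ≟_) l h
  ... | y , y∈ , refl = y∈

  unique-from-occ : ∀ w → (∀ x → x ∈ w → occN x w ≤ 1) → Unique w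
  unique-from-occ [] h = []
  unique-from-occ (y ∷ w) h = All.tabulate (λ z∈ → twice z∈)
      ∷ unique-from-occ w (λ x x∈ → ≤-trans (occ-tail x) (h x (there x∈)))
    where
    occ-tail : ∀ x → occN x w ≤ occN x (y ∷ w)
    occ-tail x = subst (occN x w ≤_) (sym (cnt-∷ (x ≟_) y w)) (m≤n+m _ _)
    twice : ∀ {z} → z ∈ w → ¬ y ≡ z
    twice z∈ refl = <-irrefl refl (≤-trans (s≤s (cnt-∈ (y ≟_) z∈ refl))
      (subst (_≤ 1) (trans (cnt-∷ (y ≟_) y w) (cong (_+ occN y w) (ind-yes (y ≟_) refl))) (h y (here refl))))

  notIn? : (w : List ℕ) → Decidable (_∉ w)
  notIn? w x = ¬? (x ∈? w)

  without : List ℕ → List ℕ → List ℕ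
  without w g = filter (notIn? w) g

  length-without : ∀ g w → Unique g → Unique w → All (_∈ g) w →
    length (without w g) + length w ≡ length g
  length-without g [] ug _ _ = trans (+-identityʳ _) (cnt-all (notIn? []) g (λ x _ ()))
  length-without g (y ∷ w) ug (y∉w ∷ uw) (y∈g ∷ wg) = begin
      cnt (notIn? (y ∷ w)) g + suc (length w)
    ≡⟨ +-suc _ _ ⟩
      suc (cnt (notIn? (y ∷ w)) g) + length w
    ≡⟨ cong (_+ length w) (trans (+-comm 1 _) (cong₂ _+_ avoidBoth onlyY)) ⟩
      cnt (notIn? w ∧? notIn? (y ∷ w)) g + cnt (notIn? w ∧? (¬? ∘ notIn? (y ∷ w))) g + length w
    ≡⟨ cong (_+ length w) (sym (cnt-split (notIn? w) (notIn? (y ∷ w)) g)) ⟩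
      cnt (notIn? w) g + length w
    ≡⟨ length-without g w ug uw wg ⟩
      length g ∎
    where
    open ≡-Reasoning
    avoidBoth : cnt (notIn? (y ∷ w)) g ≡ cnt (notIn? w ∧? notIn? (y ∷ w)) g
    avoidBoth = cnt-cong (notIn? (y ∷ w)) (notIn? w ∧? notIn? (y ∷ w)) g
      (λ x _ x∉ → (x∉ ∘ there) , x∉) (λ x _ → proj₂)
    isY : ∀ {a} → a ∉ w × ¬ a ∉ y ∷ w → a ≡ y
    isY {a} (a∉w , a∈yw) with a ≟ y
    ... | yes e = e
    ... | no a≢y = ⊥-elim (a∈yw (λ { (here e) → a≢y e ; (there i) → a∉w i }))
    onlyY : 1 ≡ cnt (notIn? w ∧? (¬? ∘ notIn? (y ∷ w))) g
    onlyY = ≤-antisym (cnt-∈ (notIn? w ∧? (¬? ∘ notIn? (y ∷ w))) y∈g ((λ i → All.lookup y∉w i refl) , λ n → n (here refl)))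
      (cnt-unique (notIn? w ∧? (¬? ∘ notIn? (y ∷ w))) g ug (λ a b pa pb → trans (isY pa) (sym (isY pb))))

  -- Peeling off the first block.  The ground set g = g0 ∷ g' is sorted, so
  -- g0 is its minimum; in a canonical partition g0 lies in the first word.
  module Peel (s r g0 : ℕ) (g' : List ℕ) (1≤s : 1 ≤ s) (sorted : AllPairs _<_ (g0 ∷ g')) where

    g : List ℕ
    g = g0 ∷ g'

    g0<g' : ∀ {x} → x ∈ g' → g0 < x
    g0<g' i = All.lookup (AP.head sorted) i

    g0≤g : ∀ {x} → x ∈ g → g0 ≤ x
    g0≤g (here refl) = ≤-refl
    g0≤g (there i) = <⇒≤ (g0<g' i)

    g0<g : ∀ {x} → x ∈ g → ¬ x ≡ g0 → g0 < x
    g0<g (here refl) x≢g0 = ⊥-elim (x≢g0 refl)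
    g0<g (there i) _ = g0<g' i

    unique-g : Unique g
    unique-g = AP.map (λ x<y e → <-irrefl e x<y) sorted

    FirstBlock : List ℕ → Set
    FirstBlock w = Unique w × g0 ∈ w × s ≤ length w × small r w ≤ 1

    firstBlock? : Decidable FirstBlock
    firstBlock? w = unique? w ×-dec (g0 ∈? w) ×-dec (s ≤? length w) ×-dec (small r w ≤? 1)

    Avoids : List ℕ → List (List ℕ) → Set
    Avoids w rest = All (All (_∉ w)) rest

    avoids? : (w : List ℕ) → Decidable (Avoids w)
    avoids? w = all? (all? (notIn? w))

    module _ (k : ℕ) (w : List ℕ) (rest : List (List ℕ)) (w⊆g : All (_∈ g) w) (rest⊆g : All (All (_∈ g)) rest) where

      peel : Partition s r g (suc k) (w ∷ rest) → FirstBlock w × Avoids w rest × Partition s r (without w g) k rest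
      peel (len , occ1 , (sw ∷ srest) , (smw ∷ smrest) , (wmin ∷ sortedRest)) =
          (unique-w , g0∈w , sw , smw) , avoids , (suc-injective len , occRest , srest , smrest , sortedRest)
        where
        occx : ∀ {x} → x ∈ g → occN x w + occN x (concat rest) ≡ 1
        occx x∈ = trans (sym (cnt-++ (_ ≟_) w (concat rest))) (All.lookup occ1 x∈)
        unique-w : Unique w
        unique-w = unique-from-occ w (λ x x∈ → subst (occN x w ≤_) (occx (All.lookup w⊆g x∈)) (m≤m+n _ _))
        -- otherwise g0 lies in a later block b, whose minimum is then ≤ g0 ≤ min w
        g0∈w : g0 ∈ w
        g0∈w with g0 ∈? w
        ... | yes p = p
        ... | no g0∉w = ⊥-elim (notLater w sw w⊆g wmin g0∈rest)
          where
          g0∈rest : g0 ∈ concat rest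
          g0∈rest = occ-∈ (≤-reflexive (sym (trans (cong (_+ occN g0 (concat rest)) (sym (occ-∉ g0∉w))) (occx (here refl)))))
          notLater : ∀ v → s ≤ length v → All (_∈ g) v → All (λ b → minimum v < minimum b) rest → g0 ∉ concat rest
          notLater [] sv _ _ _ = <-irrefl refl (≤-trans 1≤s sv)
          notLater (y ∷ l) _ v⊆g vmin g0∈ with ∈-concat⁻′ rest g0∈
          ... | b , g0∈b , b∈ = <-irrefl refl (≤-<-trans (g0≤g (All.lookup v⊆g (minimum-∈ y l)))
                  (<-≤-trans (All.lookup vmin b∈) (minimum-≤ g0∈b)))
        avoids : Avoids w rest
        avoids = All.tabulate (λ {b} b∈ → All.tabulate (λ {x} x∈b x∈w →
          <-irrefl refl (≤-trans (+-mono-≤ (cnt-∈ (x ≟_) x∈w refl) (cnt-∈ (x ≟_) (∈-concat⁺′ x∈b b∈) refl))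
            (≤-reflexive (occx (All.lookup w⊆g x∈w))))))
        occRest : All (λ x → occN x (concat rest) ≡ 1) (without w g)
        occRest = All.tabulate (λ {x} x∈ → let (x∈g , x∉w) = ∈-filter⁻ (notIn? w) x∈ in
          trans (sym (cong (_+ occN x (concat rest)) (occ-∉ x∉w))) (occx x∈g))

      unpeel : FirstBlock w → Avoids w rest → Partition s r (without w g) k rest → Partition s r g (suc k) (w ∷ rest)
      unpeel (unique-w , g0∈w , sw , smw) avoids (len , occRest , srest , smrest , sortedRest) =
          cong suc len , occ1 , sw ∷ srest , smw ∷ smrest , wmin ∷ sortedRest
        where
        notLater : ∀ {x} → x ∈ w → x ∉ concat rest
        notLater x∈w x∈c = let (b , x∈b , b∈) = ∈-concat⁻′ rest x∈c in All.lookup (All.lookup avoids b∈) x∈b x∈w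
        occx : ∀ {x} → x ∈ g → occN x w + occN x (concat rest) ≡ 1
        occx {x} x∈g with x ∈? w
        ... | yes x∈w rewrite occ-unique unique-w x∈w | occ-∉ (notLater x∈w) = refl
        ... | no x∉w rewrite occ-∉ x∉w = All.lookup occRest (∈-filter⁺ (notIn? w) x∈g x∉w)
        occ1 : All (λ x → occN x (concat (w ∷ rest)) ≡ 1) g
        occ1 = All.tabulate (λ {x} x∈g → trans (cnt-++ (x ≟_) w (concat rest)) (occx x∈g))
        -- min w = g0 is below every element of a later block
        laterMin : ∀ b → b ∈ rest → s ≤ length b → minimum w < minimum b
        laterMin [] _ sb = ⊥-elim (<-irrefl refl (≤-trans 1≤s sb))
        laterMin (y ∷ l) b∈ _ = ≤-<-trans (minimum-≤ g0∈w)
          (g0<g (All.lookup (All.lookup rest⊆g b∈) (minimum-∈ y l))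
                (λ e → All.lookup (All.lookup avoids b∈) (minimum-∈ y l) (subst (_∈ w) (sym e) g0∈w)))
        wmin : All (λ b → minimum w < minimum b) rest
        wmin = All.tabulate (λ {b} b∈ → laterMin b b∈ (All.lookup srest b∈))

    length-rest : ∀ w → Unique w → All (_∈ g) w → length (without w g) ≡ length g ∸ length w
    length-rest w uw w⊆g = trans (sym (m+n∸n≡m _ (length w))) (cong (_∸ length w) (length-without g w unique-g uw w⊆g))

    sorted-rest : ∀ w → AllPairs _<_ (without w g)
    sorted-rest w = APP.filter⁺ (notIn? w) sorted

    small-rest : ∀ w → FirstBlock w → All (_∈ g) w → small r (without w g) ≡ small r g ∸ 1
    small-rest w (uw , g0∈w , sw , smw) w⊆g with g0 <? r
    ... | yes g0<r = begin
          small r (without w g)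
        ≡⟨ cnt-of-filter (_<? r) (notIn? w) g ⟩
          cnt ((_<? r) ∧? notIn? w) g
        ≡⟨ cnt-∷ ((_<? r) ∧? notIn? w) g0 g' ⟩
          ind ((_<? r) ∧? notIn? w) g0 + cnt ((_<? r) ∧? notIn? w) g'
        ≡⟨ cong (_+ cnt ((_<? r) ∧? notIn? w) g') (ind-no ((_<? r) ∧? notIn? w) (λ p → proj₂ p g0∈w)) ⟩
          cnt ((_<? r) ∧? notIn? w) g'
        ≡⟨ cnt-cong ((_<? r) ∧? notIn? w) (_<? r) g' (λ x _ → proj₁) (λ x x∈ x<r → x<r , λ x∈w →
             <-irrefl refl (≤-<-trans (cnt-two (_<? r) w x∈w g0∈w (λ e → <-irrefl (sym e) (g0<g' x∈)) x<r g0<r) (s≤s smw))) ⟩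
          small r g'
        ≡⟨ cong (_∸ 1) (sym (trans (cnt-∷ (_<? r) g0 g') (cong (_+ small r g') (ind-yes (_<? r) g0<r)))) ⟩
          small r g ∸ 1 ∎
      where
      open ≡-Reasoning
    ... | no g0≮r = trans (cnt-zero (_<? r) (without w g) (λ x x∈ x<r → g0≮r (≤-<-trans (g0≤g (proj₁ (∈-filter⁻ (notIn? w) x∈))) x<r)))
                          (cong (_∸ 1) (sym (cnt-zero (_<? r) g (λ x x∈ x<r → g0≮r (≤-<-trans (g0≤g x∈) x<r)))))

    completions : ∀ k m w → length w ≡ m → All (_∈ g) w →
      cnt (partition? s r g (suc k) ∘ (w ∷_)) (wordLists g (length g ∸ m) k) ≡ ind firstBlock? w * G s r (without w g) k
    completions k m w lw w⊆g with firstBlock? w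
    ... | no ¬fb = trans (cnt-zero _ (wordLists g (length g ∸ m) k) (λ rest rest∈ p → ¬fb (proj₁ (peel k w rest w⊆g (rest⊆g rest∈) p))))
                         (sym (cong (_* G s r (without w g) k) (ind-no firstBlock? ¬fb)))
      where
      rest⊆g : ∀ {rest} → rest ∈ wordLists g (length g ∸ m) k → All (All (_∈ g)) rest
      rest⊆g i = proj₂ (All.lookup (wordLists-shape g (length g ∸ m) k) i)
    ... | yes fb = begin
          cnt (partition? s r g (suc k) ∘ (w ∷_)) (wordLists g T k)
        ≡⟨ cnt-cong (partition? s r g (suc k) ∘ (w ∷_)) (avoids? w ∧? partition? s r (without w g) k) (wordLists g T k)
             (λ rest rest∈ p → proj₂ (peel k w rest w⊆g (rest⊆g rest∈) p))
             (λ rest rest∈ (av , p) → unpeel k w rest w⊆g (rest⊆g rest∈) fb av p) ⟩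
          cnt (avoids? w ∧? partition? s r (without w g) k) (wordLists g T k)
        ≡⟨ cnt-wordLists-filter g (notIn? w) k (avoids? w ∧? partition? s r (without w g) k) (λ bs → proj₁) T ⟩
          cnt (avoids? w ∧? partition? s r (without w g) k) (wordLists (without w g) T k)
        ≡⟨ cnt-cong (avoids? w ∧? partition? s r (without w g) k) (partition? s r (without w g) k) (wordLists (without w g) T k)
             (λ rest _ → proj₂)
             (λ rest rest∈ p → All.map (All.map (λ x∈ → proj₂ (∈-filter⁻ (notIn? w) x∈)))
                 (proj₂ (All.lookup (wordLists-shape (without w g) T k) rest∈)) , p) ⟩
          cnt (partition? s r (without w g) k) (wordLists (without w g) T k)
        ≡⟨ cong (λ z → cnt (partition? s r (without w g) k) (wordLists (without w g) z k)) (sym lengthRest) ⟩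
          G s r (without w g) k
        ≡⟨ sym (+-identityʳ _) ⟩
          1 * G s r (without w g) k
        ≡⟨ cong (_* G s r (without w g) k) (sym (ind-yes firstBlock? fb)) ⟩
          ind firstBlock? w * G s r (without w g) k ∎
      where
      open ≡-Reasoning
      T = length g ∸ m
      rest⊆g : ∀ {rest} → rest ∈ wordLists g T k → All (All (_∈ g)) rest
      rest⊆g i = proj₂ (All.lookup (wordLists-shape g T k) i)
      lengthRest : length (without w g) ≡ T
      lengthRest = trans (length-rest w (proj₁ fb) w⊆g) (cong (length g ∸_) lw)

-- Counting words with distinct letters: falling factorials.
module InjectiveWords where

  open import Data.Nat using (ℕ; zero; suc; _+_; _*_; _∸_; _≤_; _≟_)
  open import Data.Nat.Properties
  open import Data.Nat.Solver using (module +-*-Solver)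
  open import Data.List using (List; []; _∷_; map)
  open import Data.List.Membership.Propositional using (_∈_)
  open import Data.List.Membership.DecPropositional _≟_ using (_∈?_)
  open import Data.List.Relation.Unary.All as All using (All; []; _∷_; all?)
  open import Data.List.Relation.Unary.AllPairs using (_∷_)
  open import Data.List.Relation.Unary.Unique.DecPropositional _≟_ using (Unique; unique?)
  open import Relation.Nullary using (Dec; yes; no; ¬_; ¬?)
  open import Relation.Nullary.Decidable using (_×-dec_)
  open import Relation.Unary using (Pred; Decidable)
  open import Relation.Binary.PropositionalEquality
  open import Data.Product using (_×_; _,_; proj₁; proj₂)
  open import Function using (_∘_)
  open import Level using (0ℓ)
  open import Data.Nat.ListAction using (sum)
  open import Defs using (words)
  open Counting
  open +-*-Solver

  FF : ℕ → ℕ → ℕ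
  FF x zero = 1
  FF x (suc m) = x * FF (x ∸ 1) m

  -- Pascal's rule for falling factorials: an injective m-word over x+1
  -- letters either avoids the new letter or uses it at one of m places.
  FF-pascal : ∀ x m → FF (suc x) m ≡ FF x m + m * FF x (m ∸ 1)
  FF-pascal x zero = refl
  FF-pascal zero (suc zero) = refl
  FF-pascal zero (suc (suc m)) = sym (*-zeroʳ (suc (suc m)))
  FF-pascal (suc x) (suc zero) = solve 1 (λ x → (con 2 :+ x) :* con 1 := (con 1 :+ x) :* con 1 :+ con 1 :* con 1) refl x
  FF-pascal (suc x) (suc (suc m)) = begin
      suc (suc x) * (suc x * G)
    ≡⟨ solve 2 (λ x H → (con 2 :+ x) :* H := (con 1 :+ x) :* H :+ H) refl x (suc x * G) ⟩
      suc x * (suc x * G) + suc x * G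
    ≡⟨ cong (λ z → suc x * z + suc x * G) (FF-pascal x (suc m)) ⟩
      suc x * (F + suc m * G) + suc x * G
    ≡⟨ solve 4 (λ x m F G → (con 1 :+ x) :* (F :+ (con 1 :+ m) :* G) :+ (con 1 :+ x) :* G
                           := (con 1 :+ x) :* F :+ (con 2 :+ m) :* ((con 1 :+ x) :* G)) refl x m F G ⟩
      suc x * F + suc (suc m) * (suc x * G) ∎
    where
    open ≡-Reasoning
    F = FF x (suc m)
    G = FF x m

  InjWord : Pred ℕ 0ℓ → List ℕ → Set
  InjWord B w = Unique w × All B w

  injWord? : {B : Pred ℕ 0ℓ} → Decidable B → Decidable (InjWord B)
  injWord? B? w = unique? w ×-dec all? B? w

  Containing : ℕ → Pred ℕ 0ℓ → List ℕ → Set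
  Containing a B w = InjWord B w × a ∈ w

  containing? : (a : ℕ) {B : Pred ℕ 0ℓ} → Decidable B → Decidable (Containing a B)
  containing? a B? w = injWord? B? w ×-dec (a ∈? w)

  module _ (xs : List ℕ) (unique-xs : Unique xs) where

    cnt-remove : {B : Pred ℕ 0ℓ} (B? : Decidable B) {a : ℕ} → a ∈ xs → B a →
      cnt B? xs ≡ suc (cnt (B? ∧? (¬? ∘ (a ≟_))) xs)
    cnt-remove B? {a} a∈ Ba = trans (cnt-split B? (a ≟_) xs) (cong (_+ cnt (B? ∧? (¬? ∘ (a ≟_))) xs) justA)
      where
      justA : cnt (B? ∧? (a ≟_)) xs ≡ 1
      justA = ≤-antisym (cnt-unique (B? ∧? (a ≟_)) xs unique-xs (λ x y px py → trans (sym (proj₂ px)) (proj₂ py)))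
                        (cnt-∈ (B? ∧? (a ≟_)) a∈ (Ba , refl))

    injWords-count : ∀ m {B : Pred ℕ 0ℓ} (B? : Decidable B) → cnt (injWord? B?) (words xs m) ≡ FF (cnt B? xs) m
    injWords-count zero B? = refl
    injWords-count (suc m) {B} B? = begin
        cnt (injWord? B?) (words xs (suc m))
      ≡⟨ cnt-concatMap (injWord? B?) (λ x → map (x ∷_) (words xs m)) xs ⟩
        sum′ (λ x → cnt (injWord? B?) (map (x ∷_) (words xs m)))
      ≡⟨ sum-cong _ _ xs (λ x x∈ → trans (cnt-map (injWord? B?) (x ∷_) (words xs m)) (firstLetter x x∈ (B? x))) ⟩
        sum′ (λ x → ind B? x * FF (cnt B? xs ∸ 1) m)
      ≡⟨ sum-ind B? _ xs ⟩
        cnt B? xs * FF (cnt B? xs ∸ 1) m ∎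
      where
      open ≡-Reasoning
      sum′ : (ℕ → ℕ) → ℕ
      sum′ f = sum (map f xs)
      -- with first letter x ∈ B, the tail is an injective word over B ∖ {x}
      firstLetter : ∀ x → x ∈ xs → Dec (B x) → cnt (injWord? B? ∘ (x ∷_)) (words xs m) ≡ ind B? x * FF (cnt B? xs ∸ 1) m
      firstLetter x _ (no ¬Bx) = trans (cnt-zero (injWord? B? ∘ (x ∷_)) (words xs m) (λ w _ p → ¬Bx (All.head (proj₂ p))))
                                       (sym (cong (_* FF (cnt B? xs ∸ 1) m) (ind-no B? ¬Bx)))
      firstLetter x x∈ (yes Bx) = begin
          cnt (injWord? B? ∘ (x ∷_)) (words xs m)
        ≡⟨ cnt-cong (injWord? B? ∘ (x ∷_)) (injWord? (B? ∧? (¬? ∘ (x ≟_)))) (words xs m)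
             (λ { w _ ((x∉w ∷ uw) , (_ ∷ Bw)) → uw , All.zipWith (λ (b , x≢) → b , x≢) (Bw , x∉w) })
             (λ w _ (uw , Bw) → (All.map proj₂ Bw ∷ uw) , (Bx ∷ All.map proj₁ Bw)) ⟩
          cnt (injWord? (B? ∧? (¬? ∘ (x ≟_)))) (words xs m)
        ≡⟨ injWords-count m (B? ∧? (¬? ∘ (x ≟_))) ⟩
          FF (cnt (B? ∧? (¬? ∘ (x ≟_))) xs) m
        ≡⟨ cong (λ z → FF (z ∸ 1) m) (sym (cnt-remove B? x∈ Bx)) ⟩
          FF (cnt B? xs ∸ 1) m
        ≡⟨ sym (+-identityʳ _) ⟩
          1 * FF (cnt B? xs ∸ 1) m
        ≡⟨ cong (_* FF (cnt B? xs ∸ 1) m) (sym (ind-yes B? Bx)) ⟩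
          ind B? x * FF (cnt B? xs ∸ 1) m ∎

    -- Those which moreover contain a fixed letter a ∈ B: by Pascal's rule,
    -- m · FF b (m-1) where b counts the other letters of B.
    containing-count : ∀ m {a : ℕ} → a ∈ xs → {B : Pred ℕ 0ℓ} (B? : Decidable B) → B a →
      cnt (containing? a B?) (words xs m) ≡ m * FF (cnt (B? ∧? (¬? ∘ (a ≟_))) xs) (m ∸ 1)
    containing-count m {a} a∈ {B} B? Ba = +-cancelʳ-≡ _ _ _ (begin
        cnt (containing? a B?) (words xs m) + FF b m
      ≡⟨ cong (cnt (containing? a B?) (words xs m) +_) (sym avoiding) ⟩
        cnt (containing? a B?) (words xs m) + cnt (injWord? B? ∧? (¬? ∘ (a ∈?_))) (words xs m)
      ≡⟨ sym (cnt-split (injWord? B?) (a ∈?_) (words xs m)) ⟩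
        cnt (injWord? B?) (words xs m)
      ≡⟨ injWords-count m B? ⟩
        FF (cnt B? xs) m
      ≡⟨ cong (λ z → FF z m) (cnt-remove B? a∈ Ba) ⟩
        FF (suc b) m
      ≡⟨ trans (FF-pascal b m) (+-comm (FF b m) _) ⟩
        m * FF b (m ∸ 1) + FF b m ∎)
      where
      open ≡-Reasoning
      b = cnt (B? ∧? (¬? ∘ (a ≟_))) xs
      -- the injective words avoiding a are those over B ∖ {a}
      avoiding : cnt (injWord? B? ∧? (¬? ∘ (a ∈?_))) (words xs m) ≡ FF b m
      avoiding = trans (cnt-cong (injWord? B? ∧? (¬? ∘ (a ∈?_))) (injWord? (B? ∧? (¬? ∘ (a ≟_)))) (words xs m)
        (λ w _ ((uw , Bw) , a∉w) → uw , All.tabulate (λ {y} y∈ → All.lookup Bw y∈ , λ { refl → a∉w y∈ }))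
        (λ w _ (uw , Bw) → (uw , All.map proj₁ Bw) , λ a∈w → proj₂ (All.lookup Bw a∈w) refl))
        (injWords-count m (B? ∧? (¬? ∘ (a ≟_))))

-- Finite sums Σ_{i < n} f i and their reindexings.
module Sums where

  open import Data.Nat using (ℕ; zero; suc; _+_; _*_; _∸_; _<_; _≤_; z≤n; s≤s; _≤?_)
  open import Data.Nat.Properties
  open import Data.List using (map; upTo; applyUpTo)
  open import Data.Nat.ListAction using (sum)
  open import Relation.Nullary using (yes; no)
  open import Relation.Binary.PropositionalEquality
  open import Function using (_∘_)
  open import Algebra.Properties.CommutativeSemigroup +-commutativeSemigroup using () renaming (interchange to +-interchange)
  open Counting using (ind; ind-yes; ind-no)

  S : ℕ → (ℕ → ℕ) → ℕ
  S zero f = 0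
  S (suc n) f = f 0 + S n (f ∘ suc)

  δ : ℕ → ℕ
  δ zero = 1
  δ (suc _) = 0

  ind≤ : ℕ → ℕ → ℕ
  ind≤ i j = ind (i ≤?_) j

  sum-upTo : (f : ℕ → ℕ) (n : ℕ) → sum (map f (upTo n)) ≡ S n f
  sum-upTo f n = go (λ x → x) n
    where
    go : (g : ℕ → ℕ) (n : ℕ) → sum (map f (applyUpTo g n)) ≡ S n (f ∘ g)
    go g zero = refl
    go g (suc n) = cong (f (g 0) +_) (go (g ∘ suc) n)

  S-cong : ∀ n {f g : ℕ → ℕ} → (∀ i → i < n → f i ≡ g i) → S n f ≡ S n g
  S-cong zero h = refl
  S-cong (suc n) h = cong₂ _+_ (h 0 (s≤s z≤n)) (S-cong n (λ i i< → h (suc i) (s≤s i<)))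

  S-zero : ∀ n (f : ℕ → ℕ) → (∀ i → i < n → f i ≡ 0) → S n f ≡ 0
  S-zero zero f h = refl
  S-zero (suc n) f h rewrite h 0 (s≤s z≤n) = S-zero n (f ∘ suc) (λ i i< → h (suc i) (s≤s i<))

  S-+ : ∀ n (f g : ℕ → ℕ) → S n (λ i → f i + g i) ≡ S n f + S n g
  S-+ zero f g = refl
  S-+ (suc n) f g rewrite S-+ n (f ∘ suc) (g ∘ suc) = +-interchange (f 0) (g 0) _ _

  S-*ˡ : ∀ n c (f : ℕ → ℕ) → S n (λ i → c * f i) ≡ c * S n f
  S-*ˡ zero c f = sym (*-zeroʳ c)
  S-*ˡ (suc n) c f rewrite S-*ˡ n c (f ∘ suc) = sym (*-distribˡ-+ c (f 0) _)

  S-*ʳ : ∀ n c (f : ℕ → ℕ) → S n (λ i → f i * c) ≡ S n f * c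
  S-*ʳ n c f = trans (S-cong n (λ i _ → *-comm (f i) c)) (trans (S-*ˡ n c f) (*-comm c _))

  S-split : ∀ a b (f : ℕ → ℕ) → S (a + b) f ≡ S a f + S b (λ i → f (a + i))
  S-split zero b f = refl
  S-split (suc a) b f rewrite S-split a b (f ∘ suc) = sym (+-assoc (f 0) _ _)

  S-last : ∀ n (f : ℕ → ℕ) → S (suc n) f ≡ S n f + f n
  S-last n f = begin
    S (suc n) f                        ≡⟨ cong (λ z → S z f) (+-comm 1 n) ⟩
    S (n + 1) f                        ≡⟨ S-split n 1 f ⟩
    S n f + (f (n + 0) + 0)            ≡⟨ cong (S n f +_) (trans (+-identityʳ _) (cong f (+-identityʳ n))) ⟩
    S n f + f n                        ∎
    where open ≡-Reasoning

  S-swap : ∀ n m (F : ℕ → ℕ → ℕ) → S n (λ i → S m (F i)) ≡ S m (λ j → S n (λ i → F i j))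
  S-swap zero m F = sym (S-zero m (λ j → 0) (λ _ _ → refl))
  S-swap (suc n) m F = trans (cong (S m (F 0) +_) (S-swap n m (F ∘ suc)))
                             (sym (S-+ m (F 0) (λ j → S n (λ i → F (suc i) j))))

  -- Summing over the triangle { (j₁, j) : j₁ + j ≤ N } by rows or by diagonals.
  S-triangle : ∀ N (F : ℕ → ℕ → ℕ) →
    S (suc N) (λ j₁ → S (suc (N ∸ j₁)) (F j₁)) ≡ S (suc N) (λ J → S (suc J) (λ j₁ → F j₁ (J ∸ j₁)))
  S-triangle zero F = refl
  S-triangle (suc N) F = trans (cong (S (suc (suc N)) (F 0) +_) (S-triangle N (F ∘ suc)))
    (sym (S-+ (suc (suc N)) (λ J → F 0 J) (λ J → S J (λ j₁ → F (suc j₁) (J ∸ suc j₁)))))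

  S-reverse : ∀ J (g : ℕ → ℕ) → S (suc J) (λ j → g (J ∸ j)) ≡ S (suc J) g
  S-reverse zero g = refl
  S-reverse (suc J) g = trans (cong (g (suc J) +_) (S-reverse J g))
                              (trans (+-comm (g (suc J)) _) (sym (S-last (suc J) g)))

  S-from : ∀ i N (f : ℕ → ℕ) → S (suc N ∸ i) (λ j → f (i + j)) ≡ S (suc N) (λ j → ind≤ i j * f j)
  S-from i N f with i ≤? suc N
  ... | yes i≤ = begin
      S (suc N ∸ i) (λ j → f (i + j))
    ≡⟨ S-cong (suc N ∸ i) (λ j _ → sym (trans (cong (_* f (i + j)) (ind-yes (i ≤?_) (m≤m+n i j))) (*-identityˡ _))) ⟩
      S (suc N ∸ i) (λ j → ind≤ i (i + j) * f (i + j))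
    ≡⟨ cong (_+ S (suc N ∸ i) (λ j → ind≤ i (i + j) * f (i + j)))
         (sym (S-zero i _ (λ j j<i → cong (_* f j) (ind-no (i ≤?_) (<⇒≱ j<i))))) ⟩
      S i (λ j → ind≤ i j * f j) + S (suc N ∸ i) (λ j → ind≤ i (i + j) * f (i + j))
    ≡⟨ sym (S-split i (suc N ∸ i) (λ j → ind≤ i j * f j)) ⟩
      S (i + (suc N ∸ i)) (λ j → ind≤ i j * f j)
    ≡⟨ cong (λ z → S z (λ j → ind≤ i j * f j)) (m+[n∸m]≡n i≤) ⟩
      S (suc N) (λ j → ind≤ i j * f j) ∎
    where open ≡-Reasoning
  ... | no i≰ rewrite m≤n⇒m∸n≡0 (<⇒≤ (≰⇒> i≰)) =
    sym (S-zero (suc N) _ (λ j j< → cong (_* f j) (ind-no (i ≤?_) (λ i≤j → i≰ (≤-trans i≤j (<⇒≤ j<))))))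

-- The first-block recursion Φ and its correctness for every sorted ground set.
module Recurrence where

  open import Data.Nat using (ℕ; zero; suc; _+_; _*_; _∸_; _<_; _≤_; _⊔_; _≟_; _≤?_; _<?_)
  open import Data.Nat.Properties
  open import Data.List using (List; []; _∷_; map; concatMap; length; upTo)
  open import Data.Nat.ListAction using (sum)
  open import Data.List.Membership.Propositional using (_∈_)
  open import Data.List.Relation.Unary.Any using (here; there)
  open import Data.List.Relation.Unary.All as All using (All; []; _∷_)
  open import Data.List.Relation.Unary.AllPairs using (AllPairs)
  open import Relation.Nullary using (Dec; yes; no; ¬_; ¬?)
  open import Relation.Unary using (Decidable)
  open import Relation.Binary.PropositionalEquality
  open import Data.Product using (_,_; proj₁; proj₂)
  open import Data.Sum using (_⊎_; inj₁; inj₂; [_,_]′)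
  open import Relation.Nullary.Decidable using (_⊎-dec_)
  open import Data.Empty using (⊥-elim)
  open import Function using (_∘_)
  open import Defs using (words; wordLists)
  open Counting
  open Words
  open Blocks
  open InjectiveWords
  open Sums

  -- The number of choices of a first block of size m, in a ground set of t
  -- elements of which σ are small: the minimum sits at one of m places, the
  -- other m-1 places hold distinct non-small elements (there are t - max(σ,1)).
  firstBlocks : ℕ → ℕ → ℕ → ℕ → ℕ
  firstBlocks s t σ m = m * (ind (s ≤?_) m * FF (t ∸ (σ ⊔ 1)) (m ∸ 1))

  -- Φ s t σ k: the number of canonical partitions into k ordered lists of
  -- size ≥ s of a t-element ground set with σ small elements, in pairwise
  -- distinct lists; defined by the first-block recursion (the summand is
  -- firstBlocks s t σ m · Φ s (t-m) (σ-1) k).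
  Φ : ℕ → ℕ → ℕ → ℕ → ℕ
  Φ s t σ zero = δ t
  Φ s t σ (suc k) = S (suc t) (λ m → m * (ind (s ≤?_) m * (FF (t ∸ (σ ⊔ 1)) (m ∸ 1) * Φ s (t ∸ m) (σ ∸ 1) k)))

  module FirstBlocks (s r g0 : ℕ) (g' : List ℕ) (1≤s : 1 ≤ s) (sorted : AllPairs _<_ (g0 ∷ g')) where
    open Peel s r g0 g' 1≤s sorted

    -- Apart from the minimum g0, a first block uses only non-small letters.
    Allowed : ℕ → Set
    Allowed y = g0 ≡ y ⊎ r ≤ y

    allowed? : Decidable Allowed
    allowed? y = (g0 ≟ y) ⊎-dec (r ≤? y)

    otherAllowed : cnt (allowed? ∧? (¬? ∘ (g0 ≟_))) g ≡ length g ∸ (small r g ⊔ 1)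
    otherAllowed = begin
        cnt (allowed? ∧? (¬? ∘ (g0 ≟_))) g
      ≡⟨ cnt-∷ (allowed? ∧? (¬? ∘ (g0 ≟_))) g0 g' ⟩
        ind (allowed? ∧? (¬? ∘ (g0 ≟_))) g0 + cnt (allowed? ∧? (¬? ∘ (g0 ≟_))) g'
      ≡⟨ cong (_+ cnt (allowed? ∧? (¬? ∘ (g0 ≟_))) g') (ind-no (allowed? ∧? (¬? ∘ (g0 ≟_))) (λ p → proj₂ p refl)) ⟩
        cnt (allowed? ∧? (¬? ∘ (g0 ≟_))) g'
      ≡⟨ cnt-cong (allowed? ∧? (¬? ∘ (g0 ≟_))) (¬? ∘ (_<? r)) g'
           (λ y _ → λ { (inj₁ e , g0≢y) → ⊥-elim (g0≢y e) ; (inj₂ r≤y , _) → ≤⇒≯ r≤y })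
           (λ y y∈ y≮r → inj₂ (≮⇒≥ y≮r) , λ e → <-irrefl e (g0<g' y∈)) ⟩
        cnt (¬? ∘ (_<? r)) g'
      ≡⟨ sym (m+n∸m≡n (small r g') _) ⟩
        small r g' + cnt (¬? ∘ (_<? r)) g' ∸ small r g'
      ≡⟨ cong (_∸ small r g') (cnt-compl (_<? r) g') ⟩
        length g' ∸ small r g'
      ≡⟨ headSmall (g0 <? r) ⟩
        length g ∸ (small r g ⊔ 1) ∎
      where
      open ≡-Reasoning
      -- either g0 is small, or no element at all is small
      headSmall : Dec (g0 < r) → length g' ∸ small r g' ≡ length g ∸ (small r g ⊔ 1)
      headSmall (yes g0<r) rewrite cnt-∷ (_<? r) g0 g' | ind-yes (_<? r) g0<r | ⊔-identityʳ (small r g') = refl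
      headSmall (no g0≮r) rewrite cnt-∷ (_<? r) g0 g' | ind-no (_<? r) g0≮r
                                | cnt-zero (_<? r) g' (λ y y∈ y<r → g0≮r (<-trans (g0<g' y∈) y<r)) = refl

    firstBlock⇒ : ∀ w → All (_∈ g) w → FirstBlock w → Containing g0 Allowed w
    firstBlock⇒ w w⊆g (uw , g0∈w , _ , smw) = (uw , All.tabulate allowed) , g0∈w
      where
      allowed : ∀ {y} → y ∈ w → Allowed y
      allowed {y} y∈ with g0 ≟ y
      ... | yes e = inj₁ e
      ... | no g0≢y = inj₂ (≮⇒≥ (λ y<r → <-irrefl refl (≤-trans
              (cnt-two (_<? r) w y∈ g0∈w (g0≢y ∘ sym) y<r (≤-<-trans (g0≤g (All.lookup w⊆g y∈)) y<r)) smw)))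

    firstBlock⇐ : ∀ w → s ≤ length w → Containing g0 Allowed w → FirstBlock w
    firstBlock⇐ w sw ((uw , allowedW) , g0∈w) = uw , g0∈w , sw ,
      ≤-trans (cnt-mono (_<? r) (g0 ≟_) w (λ y y∈ y<r → [ (λ e → e) , (λ r≤y → ⊥-elim (≤⇒≯ r≤y y<r)) ]′ (All.lookup allowedW y∈)))
              (cnt-unique (g0 ≟_) w uw (λ a b e₁ e₂ → trans (sym e₁) e₂))

    firstBlocks-count : ∀ m → cnt firstBlock? (words g m) ≡ firstBlocks s (length g) (small r g) m
    firstBlocks-count m with s ≤? m
    ... | no s≰m = trans (cnt-zero firstBlock? (words g m) (λ w w∈ fb → s≰m (subst (s ≤_) (lengthW w∈) (proj₁ (proj₂ (proj₂ fb))))))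
                         (sym (trans (cong (λ z → m * (z * FF _ (m ∸ 1))) (ind-no (s ≤?_) s≰m)) (*-zeroʳ m)))
      where
      lengthW : ∀ {w} → w ∈ words g m → length w ≡ m
      lengthW i = proj₁ (All.lookup (words-shape g m) i)
    ... | yes s≤m = begin
        cnt firstBlock? (words g m)
      ≡⟨ cnt-cong firstBlock? (containing? g0 allowed?) (words g m)
           (λ w w∈ → firstBlock⇒ w (proj₂ (All.lookup (words-shape g m) w∈)))
           (λ w w∈ → firstBlock⇐ w (subst (s ≤_) (sym (proj₁ (All.lookup (words-shape g m) w∈))) s≤m)) ⟩
        cnt (containing? g0 allowed?) (words g m)
      ≡⟨ containing-count g unique-g m (here refl) allowed? (inj₁ refl) ⟩
        m * FF (cnt (allowed? ∧? (¬? ∘ (g0 ≟_))) g) (m ∸ 1)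
      ≡⟨ cong (λ z → m * FF z (m ∸ 1)) otherAllowed ⟩
        m * FF (length g ∸ (small r g ⊔ 1)) (m ∸ 1)
      ≡⟨ cong (m *_) (sym (trans (cong (_* FF _ (m ∸ 1)) (ind-yes (s ≤?_) s≤m)) (*-identityˡ _))) ⟩
        firstBlocks s (length g) (small r g) m ∎
      where open ≡-Reasoning

  G≡Φ : ∀ s r k g → 1 ≤ s → AllPairs _<_ g → G s r g k ≡ Φ s (length g) (small r g) k
  G≡Φ s r zero [] 1≤s _ = refl
  G≡Φ s r zero (x ∷ g) 1≤s _ = refl
  G≡Φ s r (suc k) [] 1≤s _ = cnt-zero (partition? s r [] (suc k)) (wordLists [] 0 (suc k))
      (λ bs bs∈ → noPartition bs (proj₂ (All.lookup (wordLists-shape [] 0 (suc k)) bs∈)))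
    where
    noPartition : ∀ bs → All (All (_∈ [])) bs → ¬ Partition s r [] (suc k) bs
    noPartition ([] ∷ bs) _ (_ , _ , (s≤0 ∷ _) , _) = <-irrefl refl (≤-trans 1≤s s≤0)
    noPartition ((y ∷ b) ∷ bs) ((() ∷ _) ∷ _) _
  G≡Φ s r (suc k) (g0 ∷ g') 1≤s sorted = begin
      cnt (partition? s r g (suc k)) (concatMap candidates (upTo (suc t)))
    ≡⟨ cnt-concatMap (partition? s r g (suc k)) candidates (upTo (suc t)) ⟩
      sum (map (λ m → cnt (partition? s r g (suc k)) (candidates m)) (upTo (suc t)))
    ≡⟨ sum-cong _ _ (upTo (suc t)) (λ m _ → firstWordLength m) ⟩
      sum (map term (upTo (suc t)))
    ≡⟨ sum-upTo term (suc t) ⟩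
      Φ s t σ (suc k) ∎
    where
    open ≡-Reasoning
    open Peel s r g0 g' 1≤s sorted
    open FirstBlocks s r g0 g' 1≤s sorted
    t = length g
    σ = small r g
    candidates : ℕ → List (List (List ℕ))
    candidates m = concatMap (λ w → map (w ∷_) (wordLists g (t ∸ m) k)) (words g m)
    term : ℕ → ℕ
    term m = m * (ind (s ≤?_) m * (FF (t ∸ (σ ⊔ 1)) (m ∸ 1) * Φ s (t ∸ m) (σ ∸ 1) k))
    -- a fixed first block leaves a sorted ground set of size t-m with σ-1 small elements
    firstWord : ∀ m w → w ∈ words g m →
      cnt (partition? s r g (suc k)) (map (w ∷_) (wordLists g (t ∸ m) k)) ≡ ind firstBlock? w * Φ s (t ∸ m) (σ ∸ 1) k
    firstWord m w w∈ with All.lookup (words-shape g m) w∈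
    ... | lw , w⊆g = trans (cnt-map (partition? s r g (suc k)) (w ∷_) (wordLists g (t ∸ m) k))
                           (trans (completions k m w lw w⊆g) (recurse (firstBlock? w)))
      where
      recurse : Dec (FirstBlock w) → ind firstBlock? w * G s r (without w g) k ≡ ind firstBlock? w * Φ s (t ∸ m) (σ ∸ 1) k
      recurse (no ¬fb) rewrite ind-no firstBlock? ¬fb = refl
      recurse (yes fb) = cong (ind firstBlock? w *_) (trans (G≡Φ s r k (without w g) 1≤s (sorted-rest w))
        (cong₂ (λ a b → Φ s a b k) (trans (length-rest w (proj₁ fb) w⊆g) (cong (t ∸_) lw)) (small-rest w fb w⊆g)))
    firstWordLength : ∀ m → cnt (partition? s r g (suc k)) (candidates m) ≡ term m
    firstWordLength m = begin
        cnt (partition? s r g (suc k)) (candidates m)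
      ≡⟨ cnt-concatMap (partition? s r g (suc k)) (λ w → map (w ∷_) (wordLists g (t ∸ m) k)) (words g m) ⟩
        sum (map (λ w → cnt (partition? s r g (suc k)) (map (w ∷_) (wordLists g (t ∸ m) k))) (words g m))
      ≡⟨ sum-cong _ _ (words g m) (firstWord m) ⟩
        sum (map (λ w → ind firstBlock? w * Φ s (t ∸ m) (σ ∸ 1) k) (words g m))
      ≡⟨ sum-ind firstBlock? (Φ s (t ∸ m) (σ ∸ 1) k) (words g m) ⟩
        cnt firstBlock? (words g m) * Φ s (t ∸ m) (σ ∸ 1) k
      ≡⟨ cong (_* Φ s (t ∸ m) (σ ∸ 1) k) (firstBlocks-count m) ⟩
        firstBlocks s t σ m * Φ s (t ∸ m) (σ ∸ 1) k
      ≡⟨ trans (*-assoc m _ _) (cong (m *_) (*-assoc (ind (s ≤?_) m) _ _)) ⟩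
        term m ∎

-- Transfer from the definition of L over Fin n to the ground set 0, …, n-1.
module FinTransfer where

  open import Data.Nat using (ℕ; zero; suc; _+_; _∸_; _<_; _≤_; z≤n; s≤s; _⊓_; _≟_; _<?_)
  open import Data.Nat.Properties
  open import Data.Fin using (Fin; toℕ)
  import Data.Fin.Properties as FinP
  open import Data.List using (List; []; _∷_; map; concat; length; upTo; applyUpTo; tabulate; allFin; foldr)
  open import Data.List.Properties using (length-map; concat-map; length-upTo; map-tabulate)
  open import Data.List.Membership.Propositional.Properties using (∈-allFin)
  open import Data.List.Relation.Unary.All as All using (All; []; _∷_)
  import Data.List.Relation.Unary.All.Properties as AllP
  open import Data.List.Relation.Unary.AllPairs using (AllPairs; []; _∷_)
  import Data.List.Relation.Unary.AllPairs.Properties as APP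
  open import Relation.Nullary using (Dec; yes; no)
  open import Relation.Binary.PropositionalEquality
  open import Data.Product using (_,_)
  open import Data.Empty using (⊥-elim)
  open import Function using (_∘_)
  open import Defs
  open Counting
  open Words using (wordLists-map)
  open Blocks
  open Recurrence using (Φ; G≡Φ)

  upTo-toℕ : ∀ n → map toℕ (allFin n) ≡ upTo n
  upTo-toℕ n = trans (map-tabulate (λ x → x) toℕ) (tabulate-toℕ n (λ x → x))
    where
    tabulate-toℕ : ∀ n (f : ℕ → ℕ) → tabulate {n = n} (f ∘ toℕ) ≡ applyUpTo f n
    tabulate-toℕ zero f = refl
    tabulate-toℕ (suc n) f = cong (f 0 ∷_) (tabulate-toℕ n (f ∘ suc))

  sorted-upTo : ∀ n → AllPairs _<_ (upTo n)
  sorted-upTo n = go (λ x → x) n (λ i<j → i<j)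
    where
    go : ∀ (f : ℕ → ℕ) n → (∀ {i j} → i < j → f i < f j) → AllPairs _<_ (applyUpTo f n)
    go f zero mono = []
    go f (suc n) mono = AllP.applyUpTo⁺₂ (f ∘ suc) n (λ i → mono (s≤s z≤n)) ∷ go (f ∘ suc) n (λ i<j → mono (s≤s i<j))

  applyUpTo-cong : ∀ {f h : ℕ → ℕ} n → (∀ i → f i ≡ h i) → applyUpTo f n ≡ applyUpTo h n
  applyUpTo-cong zero e = refl
  applyUpTo-cong (suc n) e = cong₂ _∷_ (e 0) (applyUpTo-cong n (e ∘ suc))

  small-upTo : ∀ r n → small r (upTo n) ≡ r ⊓ n
  small-upTo r n = go 0 n
    where
    go : ∀ a n → small r (applyUpTo (a +_) n) ≡ (r ∸ a) ⊓ n
    go a zero = sym (⊓-zeroʳ (r ∸ a))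
    go a (suc n) = begin
        small r (applyUpTo (a +_) (suc n))
      ≡⟨ cnt-∷ (_<? r) (a + 0) (applyUpTo (λ i → a + suc i) n) ⟩
        ind (_<? r) (a + 0) + small r (applyUpTo (λ i → a + suc i) n)
      ≡⟨ cong₂ (λ x l → ind (_<? r) x + small r l) (+-identityʳ a) (applyUpTo-shift n) ⟩
        ind (_<? r) a + small r (applyUpTo (suc a +_) n)
      ≡⟨ cong (ind (_<? r) a +_) (go (suc a) n) ⟩
        ind (_<? r) a + (r ∸ suc a) ⊓ n
      ≡⟨ head (a <? r) ⟩
        (r ∸ a) ⊓ suc n ∎
      where
      open ≡-Reasoning
      applyUpTo-shift : ∀ n → applyUpTo (λ i → a + suc i) n ≡ applyUpTo (suc a +_) n
      applyUpTo-shift n = applyUpTo-cong n (λ i → +-suc a i)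
      head : Dec (a < r) → ind (_<? r) a + (r ∸ suc a) ⊓ n ≡ (r ∸ a) ⊓ suc n
      head (yes a<r) rewrite ind-yes (_<? r) a<r | +-∸-assoc 1 a<r = refl
      head (no a≮r) rewrite ind-no (_<? r) a≮r | m≤n⇒m∸n≡0 (≮⇒≥ a≮r) | m≤n⇒m∸n≡0 (≤-trans (≮⇒≥ a≮r) (n≤1+n a)) = refl

  foldr-minimum : ∀ (n x : ℕ) l → All (_≤ n) (x ∷ l) → foldr _⊓_ n (x ∷ l) ≡ minimum (x ∷ l)
  foldr-minimum n x [] (x≤n ∷ []) = m≤n⇒m⊓n≡m x≤n
  foldr-minimum n x (y ∷ l) (_ ∷ rest) = cong (x ⊓_) (foldr-minimum n y l rest)

  AllPairs-weaken : ∀ {A : Set} {Q : A → Set} {R R′ : A → A → Set} {xs} → All Q xs → AllPairs R xs →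
    (∀ {a b} → Q a → Q b → R a b → R′ a b) → AllPairs R′ xs
  AllPairs-weaken [] [] f = []
  AllPairs-weaken (q ∷ qs) (r ∷ rs) f = All.zipWith (λ (q′ , r′) → f q q′ r′) (qs , r) ∷ AllPairs-weaken qs rs f

  module _ (s r n k : ℕ) (1≤s : 1 ≤ s) where

    toℕs : List (List (Fin n)) → List (List ℕ)
    toℕs = map (map toℕ)

    occ-toℕ : ∀ (x : Fin n) l → occN (toℕ x) (map toℕ l) ≡ occ x l
    occ-toℕ x l = trans (cnt-map (toℕ x ≟_) toℕ l)
      (cnt-cong (λ y → toℕ x ≟ toℕ y) (x FinP.≟_) l (λ y _ → FinP.toℕ-injective) (λ y _ → cong toℕ))

    blockMin-toℕ : ∀ (b : List (Fin n)) → s ≤ length b → blockMin b ≡ minimum (map toℕ b)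
    blockMin-toℕ [] sb = ⊥-elim (<-irrefl refl (≤-trans 1≤s sb))
    blockMin-toℕ (x ∷ b) sb = foldr-minimum n (toℕ x) (map toℕ b) (AllP.map⁺ (All.tabulate (λ {y} _ → <⇒≤ (FinP.toℕ<n y))))

    cover⇒ : ∀ bs → ((x : Fin n) → occ x (concat bs) ≡ 1) → All (λ y → occN y (concat (toℕs bs)) ≡ 1) (upTo n)
    cover⇒ bs h = subst (All _) (upTo-toℕ n) (AllP.map⁺ (All.tabulate (λ {x} _ →
      trans (cong (occN (toℕ x)) (concat-map bs)) (trans (occ-toℕ x (concat bs)) (h x)))))

    cover⇐ : ∀ bs → All (λ y → occN y (concat (toℕs bs)) ≡ 1) (upTo n) → ((x : Fin n) → occ x (concat bs) ≡ 1)
    cover⇐ bs h x = trans (sym (occ-toℕ x (concat bs))) (trans (cong (occN (toℕ x)) (sym (concat-map bs)))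
      (All.lookup (AllP.map⁻ (subst (All _) (sym (upTo-toℕ n)) h)) (∈-allFin x)))

    isOLP⇒ : ∀ bs → IsOLP s r n k bs → Partition s r (upTo n) k (toℕs bs)
    isOLP⇒ bs (len , cover , sizes , smalls , order) =
      trans (length-map _ bs) len , cover⇒ bs cover ,
      AllP.map⁺ (All.map (λ {b} p → subst (s ≤_) (sym (length-map toℕ b)) p) sizes) ,
      AllP.map⁺ (All.map (λ {b} p → subst (_≤ 1) (sym (cnt-map (_<? r) toℕ b)) p) smalls) ,
      APP.map⁺ (AllPairs-weaken sizes order (λ {b} {b′} sb sb′ → subst₂ _<_ (blockMin-toℕ b sb) (blockMin-toℕ b′ sb′)))

    isOLP⇐ : ∀ bs → Partition s r (upTo n) k (toℕs bs) → IsOLP s r n k bs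
    isOLP⇐ bs (len , cover , sizes , smalls , order) =
      trans (sym (length-map _ bs)) len , cover⇐ bs cover , sizes′ ,
      All.map (λ {b} p → subst (_≤ 1) (cnt-map (_<? r) toℕ b) p) (AllP.map⁻ smalls) ,
      AllPairs-weaken sizes′ (APP.map⁻ order) (λ {b} {b′} sb sb′ → subst₂ _<_ (sym (blockMin-toℕ b sb)) (sym (blockMin-toℕ b′ sb′)))
      where
      sizes′ = All.map (λ {b} p → subst (s ≤_) (length-map toℕ b) p) (AllP.map⁻ sizes)

    L≡G : L s r n k ≡ G s r (upTo n) k
    L≡G = begin
        cnt (isOLP? s r n k) (wordLists (allFin n) n k)
      ≡⟨ cnt-cong (isOLP? s r n k) (partition? s r (upTo n) k ∘ toℕs) (wordLists (allFin n) n k) (λ bs _ → isOLP⇒ bs) (λ bs _ → isOLP⇐ bs) ⟩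
        cnt (partition? s r (upTo n) k ∘ toℕs) (wordLists (allFin n) n k)
      ≡⟨ sym (cnt-map (partition? s r (upTo n) k) toℕs (wordLists (allFin n) n k)) ⟩
        cnt (partition? s r (upTo n) k) (map toℕs (wordLists (allFin n) n k))
      ≡⟨ cong (cnt (partition? s r (upTo n) k)) (sym (wordLists-map toℕ (allFin n) n k)) ⟩
        cnt (partition? s r (upTo n) k) (wordLists (map toℕ (allFin n)) n k)
      ≡⟨ cong₂ (λ a b → cnt (partition? s r (upTo n) k) (wordLists a b k)) (upTo-toℕ n) (sym (length-upTo n)) ⟩
        G s r (upTo n) k ∎
      where open ≡-Reasoning

  L≡Φ : ∀ s r n k → 1 ≤ s → L s r n k ≡ Φ s n (r ⊓ n) k
  L≡Φ s r n k 1≤s = trans (L≡G s r n k 1≤s) (trans (G≡Φ s r k (upTo n) 1≤s (sorted-upTo n))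
    (cong₂ (λ a b → Φ s a b k) (length-upTo n) (small-upTo r n)))

-- Unrolling the recursion Φ through the p blocks containing the first p small elements.
module Unrolling where

  open import Data.Nat using (ℕ; zero; suc; _+_; _*_; _∸_; _<_; _≤_; z≤n; s≤s; _⊔_; _≤?_)
  open import Data.Nat.Properties
  open import Data.Nat.Solver using (module +-*-Solver)
  open import Relation.Nullary using (Dec; yes; no)
  open import Relation.Binary.PropositionalEquality
  open import Data.Empty using (⊥-elim)
  open Counting using (ind; ind-yes; ind-no)
  open InjectiveWords using (FF)
  open Sums
  open Recurrence using (Φ)
  open +-*-Solver

  FF-split : ∀ x m m′ → FF x (m + m′) ≡ FF x m * FF (x ∸ m) m′
  FF-split x zero m′ = sym (+-identityʳ _)
  FF-split x (suc m) m′ rewrite FF-split (x ∸ 1) m m′ | ∸-+-assoc x 1 m = sym (*-assoc x _ _)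

  ∸-identity : ∀ {x y d} → x ≡ y + d → x ∸ y ≡ d
  ∸-identity {x} {y} {d} e = trans (cong (_∸ y) e) (m+n∸m≡n y d)

  *-zeroʳ³ : ∀ a b c → a * (b * (c * 0)) ≡ 0
  *-zeroʳ³ a b c = solve 3 (λ a b c → a :* (b :* (c :* con 0)) := con 0) refl a b c

  module _ (c : ℕ) where

    s : ℕ
    s = suc c

    -- A p j = [x^j] (Σ_m (s + m) x^m)^p: the total weight of the ways to
    -- choose p consecutive first blocks of sizes s + j₁, …, s + j_p with
    -- j₁ + ⋯ + j_p = j, a block of size s + j₁ having weight s + j₁.
    A : ℕ → ℕ → ℕ
    A zero j = δ j
    A (suc p) J = S (suc J) (λ j₁ → (s + j₁) * A p (J ∸ j₁))

    Φ-zero : ∀ k t σ → t < s * k → Φ s t σ k ≡ 0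
    Φ-zero zero t σ t<0 rewrite *-zeroʳ s = ⊥-elim (<-irrefl refl (≤-trans t<0 z≤n))
    Φ-zero (suc k) t σ t< = S-zero (suc t) _ (λ m m≤t → term m m≤t (s ≤? m))
      where
      term : ∀ m → m < suc t → Dec (s ≤ m) →
        m * (ind (s ≤?_) m * (FF (t ∸ (σ ⊔ 1)) (m ∸ 1) * Φ s (t ∸ m) (σ ∸ 1) k)) ≡ 0
      term m _ (no s≰m) rewrite ind-no (s ≤?_) s≰m = *-zeroʳ m
      term m (s≤s m≤t) (yes s≤m) = trans (cong (λ z → m * (ind (s ≤?_) m * (FF (t ∸ (σ ⊔ 1)) (m ∸ 1) * z))) (Φ-zero k (t ∸ m) (σ ∸ 1) rest<))
                                         (*-zeroʳ³ m (ind (s ≤?_) m) (FF (t ∸ (σ ⊔ 1)) (m ∸ 1)))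
        where
        -- t - m < s k, since t < s + s k and m ≥ s
        rest< : t ∸ m < s * k
        rest< = ≤-<-trans (∸-monoʳ-≤ t s≤m)
          (+-cancelˡ-< s _ _ (subst (_< s + s * k) (sym (m+[n∸m]≡n (≤-trans s≤m m≤t))) (subst (t <_) (*-suc s k) t<)))

    -- With t = s(K+1) + N elements, the first block has size s + j₁ for some
    -- j₁ ≤ N: smaller blocks are forbidden, larger ones leave too few elements.
    Φ-firstBlock : ∀ σ K N → Φ s (s * suc K + N) (suc σ) (suc K) ≡
      S (suc N) (λ j₁ → (s + j₁) * (FF (s * suc K + N ∸ suc σ) (c + j₁) * Φ s (s * K + (N ∸ j₁)) σ K))
    Φ-firstBlock σ K N = begin
        Φ s t (suc σ) (suc K)
      ≡⟨ S-cong (suc t) (λ m _ → cong (λ z → m * (ind (s ≤?_) m * (FF (t ∸ suc z) (m ∸ 1) * Φ s (t ∸ m) σ K))) (⊔-identityʳ σ)) ⟩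
        S (suc t) g
      ≡⟨ cong (λ z → S z g) range ⟩
        S (s + (suc N + s * K)) g
      ≡⟨ S-split s (suc N + s * K) g ⟩
        S s g + S (suc N + s * K) (λ i → g (s + i))
      ≡⟨ cong₂ _+_ (S-zero s g tooSmall) (S-split (suc N) (s * K) (λ i → g (s + i))) ⟩
        S (suc N) (λ j₁ → g (s + j₁)) + S (s * K) (λ i → g (s + (suc N + i)))
      ≡⟨ cong (S (suc N) (λ j₁ → g (s + j₁)) +_) (S-zero (s * K) _ tooLarge) ⟩
        S (suc N) (λ j₁ → g (s + j₁)) + 0
      ≡⟨ +-identityʳ _ ⟩
        S (suc N) (λ j₁ → g (s + j₁))
      ≡⟨ S-cong (suc N) admissible ⟩
        S (suc N) (λ j₁ → (s + j₁) * (FF (t ∸ suc σ) (c + j₁) * Φ s (s * K + (N ∸ j₁)) σ K)) ∎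
      where
      open ≡-Reasoning
      t = s * suc K + N
      g : ℕ → ℕ
      g m = m * (ind (s ≤?_) m * (FF (t ∸ suc σ) (m ∸ 1) * Φ s (t ∸ m) σ K))
      range : suc t ≡ s + (suc N + s * K)
      range = solve 3 (λ c K N → con 1 :+ ((con 1 :+ c) :* (con 1 :+ K) :+ N) := (con 1 :+ c) :+ (con 1 :+ N :+ (con 1 :+ c) :* K)) refl c K N
      tooSmall : ∀ m → m < s → g m ≡ 0
      tooSmall m m<s rewrite ind-no (s ≤?_) (<⇒≱ m<s) = *-zeroʳ m
      tooLarge : ∀ i → i < s * K → g (s + (suc N + i)) ≡ 0
      tooLarge i i< = trans (cong (λ z → M * (ind (s ≤?_) M * (FF (t ∸ suc σ) (M ∸ 1) * z))) (Φ-zero K (t ∸ M) σ rest<))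
                            (*-zeroʳ³ M (ind (s ≤?_) M) (FF (t ∸ suc σ) (M ∸ 1)))
        where
        M = s + (suc N + i)
        d = s * K ∸ suc i
        t≡M+d : t ≡ M + d
        t≡M+d = begin
            s * suc K + N         ≡⟨ cong (_+ N) (*-suc s K) ⟩
            s + s * K + N         ≡⟨ cong (λ z → s + z + N) (sym (m+[n∸m]≡n i<)) ⟩
            s + (suc i + d) + N   ≡⟨ solve 4 (λ s i d N → s :+ (con 1 :+ i :+ d) :+ N := s :+ (con 1 :+ N :+ i) :+ d) refl s i d N ⟩
            M + d                 ∎
        rest< : t ∸ M < s * K
        rest< = subst (_< s * K) (sym (∸-identity {y = M} t≡M+d)) (subst (d <_) (m+[n∸m]≡n i<) (m<n+m d (s≤s z≤n)))
      admissible : ∀ j₁ → j₁ < suc N → g (s + j₁) ≡ (s + j₁) * (FF (t ∸ suc σ) (c + j₁) * Φ s (s * K + (N ∸ j₁)) σ K)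
      admissible j₁ (s≤s j₁≤N) rewrite ind-yes (s ≤?_) (m≤m+n s j₁) | *-identityˡ (FF (t ∸ suc σ) (c + j₁) * Φ s (t ∸ (s + j₁)) σ K) =
        cong (λ v → (s + j₁) * (FF (t ∸ suc σ) (c + j₁) * Φ s v σ K)) (∸-identity {y = s + j₁} (trans (cong (s * suc K +_) (sym (m+[n∸m]≡n j₁≤N)))
          (solve 4 (λ s K j₁ N′ → s :* (con 1 :+ K) :+ (j₁ :+ N′) := (s :+ j₁) :+ (s :* K :+ N′)) refl s K j₁ (N ∸ j₁))))

    -- Unrolling the recursion through the first p blocks (which carry the
    -- small elements 1, …, p): with r = p + a, k = p + a + b, n = s k + N,
    -- the sizes s + j₁, … of these blocks contribute weight A p j with
    -- j = Σ jᵢ, the ordered fillings contribute FF (n - r) (j + (s-1) p), and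
    -- the rest is a partition of s (a + b) + (N - j) elements.
    Φ-unroll : ∀ p a b N → Φ s (s * (p + a + b) + N) (p + a) (p + a + b) ≡
      S (suc N) (λ j → FF (c * (p + a + b) + b + N) (j + c * p) * A p j * Φ s (s * (a + b) + (N ∸ j)) a (a + b))
    Φ-unroll zero a b N = sym (trans (cong₂ _+_ firstTerm otherTerms) (+-identityʳ _))
      where
      firstTerm : FF (c * (a + b) + b + N) (0 + c * 0) * A 0 0 * Φ s (s * (a + b) + (N ∸ 0)) a (a + b) ≡ Φ s (s * (a + b) + N) a (a + b)
      firstTerm rewrite *-zeroʳ c = +-identityʳ _
      otherTerms : S N (λ j → FF (c * (a + b) + b + N) (suc j + c * 0) * A 0 (suc j) * Φ s (s * (a + b) + (N ∸ suc j)) a (a + b)) ≡ 0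
      otherTerms = S-zero N _ (λ j _ → cong (_* Φ s (s * (a + b) + (N ∸ suc j)) a (a + b)) (*-zeroʳ (FF (c * (a + b) + b + N) (suc j + c * 0))))
    Φ-unroll (suc p) a b N = begin
        Φ s (s * suc K + N) (suc (p + a)) (suc K)
      ≡⟨ Φ-firstBlock (p + a) K N ⟩
        S (suc N) (λ j₁ → (s + j₁) * (FF (s * suc K + N ∸ suc (p + a)) (c + j₁) * Φ s (s * K + (N ∸ j₁)) (p + a) K))
      ≡⟨ S-cong (suc N) (λ j₁ j₁< → remainingBlocks j₁ (≤-pred j₁<)) ⟩
        S (suc N) (λ j₁ → S (suc (N ∸ j₁)) (F j₁))
      ≡⟨ S-triangle N F ⟩
        S (suc N) (λ J → S (suc J) (λ j₁ → F j₁ (J ∸ j₁)))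
      ≡⟨ S-cong (suc N) (λ J _ → convolution J) ⟩
        S (suc N) (λ J → FF X (J + c * suc p) * A (suc p) J * Φ s (s * (a + b) + (N ∸ J)) a (a + b)) ∎
      where
      open ≡-Reasoning
      K = p + a + b
      X = c * suc K + b + N
      -- the term for first-block excess j₁ and excess j of the next p blocks
      F : ℕ → ℕ → ℕ
      F j₁ j = (s + j₁) * A p j * FF X ((c + j₁) + (j + c * p)) * Φ s (s * (a + b) + (N ∸ j₁ ∸ j)) a (a + b)
      remainingBlocks : ∀ j₁ → j₁ ≤ N →
        (s + j₁) * (FF (s * suc K + N ∸ suc (p + a)) (c + j₁) * Φ s (s * K + (N ∸ j₁)) (p + a) K) ≡ S (suc (N ∸ j₁)) (F j₁)
      remainingBlocks j₁ j₁≤N = begin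
          (s + j₁) * (FF (s * suc K + N ∸ suc (p + a)) (c + j₁) * Φ s (s * K + N′) (p + a) K)
        ≡⟨ cong (λ u → (s + j₁) * (FF u (c + j₁) * Φ s (s * K + N′) (p + a) K)) X-first ⟩
          (s + j₁) * (FF X (c + j₁) * Φ s (s * K + N′) (p + a) K)
        ≡⟨ cong (λ z → (s + j₁) * (FF X (c + j₁) * z)) (Φ-unroll p a b N′) ⟩
          (s + j₁) * (FF X (c + j₁) * S (suc N′) H)
        ≡⟨ trans (cong ((s + j₁) *_) (sym (S-*ˡ (suc N′) (FF X (c + j₁)) H))) (sym (S-*ˡ (suc N′) (s + j₁) (λ j → FF X (c + j₁) * H j))) ⟩
          S (suc N′) (λ j → (s + j₁) * (FF X (c + j₁) * H j))
        ≡⟨ S-cong (suc N′) (λ j _ → regroup j) ⟩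
          S (suc N′) (F j₁) ∎
        where
        N′ = N ∸ j₁
        H : ℕ → ℕ
        H j = FF (c * K + b + N′) (j + c * p) * A p j * Φ s (s * (a + b) + (N′ ∸ j)) a (a + b)
        X-first : s * suc K + N ∸ suc (p + a) ≡ X
        X-first = ∸-identity {y = suc (p + a)} (solve 5 (λ c p a b N → (con 1 :+ c) :* (con 1 :+ (p :+ a :+ b)) :+ N :=
                    (con 1 :+ (p :+ a)) :+ (c :* (con 1 :+ (p :+ a :+ b)) :+ b :+ N)) refl c p a b N)
        X-rest : X ∸ (c + j₁) ≡ c * K + b + N′
        X-rest = ∸-identity {y = c + j₁} (trans (cong (c * suc K + b +_) (sym (m+[n∸m]≡n j₁≤N)))
                   (solve 5 (λ c K b j₁ N′ → c :* (con 1 :+ K) :+ b :+ (j₁ :+ N′) := (c :+ j₁) :+ (c :* K :+ b :+ N′)) refl c K b j₁ N′))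
        -- the two falling factorials merge into one (FF-split)
        regroup : ∀ j → (s + j₁) * (FF X (c + j₁) * H j) ≡ F j₁ j
        regroup j = begin
            (s + j₁) * (FF X (c + j₁) * (FF (c * K + b + N′) (j + c * p) * A p j * Ψ))
          ≡⟨ cong (λ z → (s + j₁) * (FF X (c + j₁) * (FF z (j + c * p) * A p j * Ψ))) (sym X-rest) ⟩
            (s + j₁) * (FF X (c + j₁) * (FF (X ∸ (c + j₁)) (j + c * p) * A p j * Ψ))
          ≡⟨ solve 5 (λ x u v w φ → x :* (u :* (v :* w :* φ)) := x :* w :* (u :* v) :* φ) refl
               (s + j₁) (FF X (c + j₁)) (FF (X ∸ (c + j₁)) (j + c * p)) (A p j) Ψ ⟩
            (s + j₁) * A p j * (FF X (c + j₁) * FF (X ∸ (c + j₁)) (j + c * p)) * Ψ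
          ≡⟨ cong (λ z → (s + j₁) * A p j * z * Ψ) (sym (FF-split X (c + j₁) (j + c * p))) ⟩
            F j₁ j ∎
          where Ψ = Φ s (s * (a + b) + (N′ ∸ j)) a (a + b)
      -- summing over the split J = j₁ + (J - j₁) is the convolution defining A (p+1)
      convolution : ∀ J → S (suc J) (λ j₁ → F j₁ (J ∸ j₁)) ≡
        FF X (J + c * suc p) * A (suc p) J * Φ s (s * (a + b) + (N ∸ J)) a (a + b)
      convolution J = begin
          S (suc J) (λ j₁ → F j₁ (J ∸ j₁))
        ≡⟨ S-cong (suc J) (λ j₁ j₁< → termJ j₁ (≤-pred j₁<)) ⟩
          S (suc J) (λ j₁ → (s + j₁) * A p (J ∸ j₁) * W)
        ≡⟨ S-*ʳ (suc J) W (λ j₁ → (s + j₁) * A p (J ∸ j₁)) ⟩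
          A (suc p) J * W
        ≡⟨ solve 3 (λ x u v → x :* (u :* v) := u :* x :* v) refl (A (suc p) J) (FF X (J + c * suc p)) (Φ s (s * (a + b) + (N ∸ J)) a (a + b)) ⟩
          FF X (J + c * suc p) * A (suc p) J * Φ s (s * (a + b) + (N ∸ J)) a (a + b) ∎
        where
        W = FF X (J + c * suc p) * Φ s (s * (a + b) + (N ∸ J)) a (a + b)
        termJ : ∀ j₁ → j₁ ≤ J → F j₁ (J ∸ j₁) ≡ (s + j₁) * A p (J ∸ j₁) * W
        termJ j₁ j₁≤J = trans (cong₂ (λ u v → (s + j₁) * A p (J ∸ j₁) * FF X u * Φ s (s * (a + b) + v) a (a + b)) size rest)
                              (*-assoc ((s + j₁) * A p (J ∸ j₁)) _ _)
          where
          size : (c + j₁) + ((J ∸ j₁) + c * p) ≡ J + c * suc p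
          size = trans (solve 4 (λ c j₁ J′ p → (c :+ j₁) :+ (J′ :+ c :* p) := (j₁ :+ J′) :+ c :* (con 1 :+ p)) refl c j₁ (J ∸ j₁) p)
                       (cong (_+ c * suc p) (m+[n∸m]≡n j₁≤J))
          rest : N ∸ j₁ ∸ (J ∸ j₁) ≡ N ∸ J
          rest = trans (∸-+-assoc N j₁ (J ∸ j₁)) (cong (N ∸_) (m+[n∸m]≡n j₁≤J))

-- The binomial expansion of the block weights A.
module Binomial where

  open import Data.Nat using (ℕ; zero; suc; _+_; _*_; _∸_; _<_; _≤_; s≤s; _^_; _≤?_)
  open import Data.Nat.Properties
  open import Data.Nat.Combinatorics using (_C_; nCk+nC[k+1]≡[n+1]C[k+1])
  open import Data.Nat.Solver using (module +-*-Solver)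
  open import Relation.Nullary using (Dec; yes; no)
  open import Relation.Binary.PropositionalEquality
  open import Function using (_∘_)
  open Counting using (ind-yes; ind-no)
  open Sums
  open Unrolling using (A)
  open +-*-Solver

  bin : ℕ → ℕ → ℕ
  bin n zero = 1
  bin zero (suc k) = 0
  bin (suc n) (suc k) = bin n k + bin n (suc k)

  C≡bin : ∀ n k → n C k ≡ bin n k
  C≡bin n zero = refl
  C≡bin zero (suc k) = refl
  C≡bin (suc n) (suc k) = trans (sym (nCk+nC[k+1]≡[n+1]C[k+1] n k)) (cong₂ _+_ (C≡bin n k) (C≡bin n (suc k)))

  bin-big : ∀ n k → n < k → bin n k ≡ 0
  bin-big zero (suc k) _ = refl
  bin-big (suc n) (suc k) (s≤s n<k) rewrite bin-big n k n<k | bin-big n (suc k) (≤-trans n<k (n≤1+n k)) = refl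

  hockey : ∀ q M → S (suc M) (λ t → bin (q + t ∸ 1) t) ≡ bin (q + M) M
  hockey q zero = +-identityʳ _
  hockey q (suc M) = begin
      S (suc (suc M)) (λ t → bin (q + t ∸ 1) t)
    ≡⟨ S-last (suc M) (λ t → bin (q + t ∸ 1) t) ⟩
      S (suc M) (λ t → bin (q + t ∸ 1) t) + bin (q + suc M ∸ 1) (suc M)
    ≡⟨ cong₂ _+_ (hockey q M) (cong (λ z → bin (z ∸ 1) (suc M)) (+-suc q M)) ⟩
      bin (q + M) M + bin (q + M) (suc M)
    ≡⟨ cong (λ z → bin z (suc M)) (sym (+-suc q M)) ⟩
      bin (q + suc M) (suc M) ∎
    where open ≡-Reasoning

  -- e q i j = [x^j] x^i / (1-x)^q = [i ≤ j] C(q + (j-i) - 1, j-i).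
  e : ℕ → ℕ → ℕ → ℕ
  e q i j = ind≤ i j * bin (q + (j ∸ i) ∸ 1) (j ∸ i)

  -- Multiplication by 1/(1-x): prefix sums.
  prefix-e : ∀ q i J → S (suc J) (e q i) ≡ e (suc q) i J
  prefix-e q i J with i ≤? J
  ... | yes i≤J = begin
      S (suc J) (e q i)
    ≡⟨ sym (S-from i J (λ j → bin (q + (j ∸ i) ∸ 1) (j ∸ i))) ⟩
      S (suc J ∸ i) (λ j′ → bin (q + (i + j′ ∸ i) ∸ 1) (i + j′ ∸ i))
    ≡⟨ S-cong (suc J ∸ i) (λ j′ _ → cong (λ z → bin (q + z ∸ 1) z) (m+n∸m≡n i j′)) ⟩
      S (suc J ∸ i) (λ t → bin (q + t ∸ 1) t)
    ≡⟨ cong (λ z → S z (λ t → bin (q + t ∸ 1) t)) (+-∸-assoc 1 i≤J) ⟩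
      S (suc (J ∸ i)) (λ t → bin (q + t ∸ 1) t)
    ≡⟨ hockey q (J ∸ i) ⟩
      bin (q + (J ∸ i)) (J ∸ i)
    ≡⟨ sym (trans (cong (_* bin (q + (J ∸ i)) (J ∸ i)) (ind-yes (i ≤?_) i≤J)) (+-identityʳ _)) ⟩
      e (suc q) i J ∎
    where open ≡-Reasoning
  ... | no i≰J = trans (S-zero (suc J) (e q i) (λ j j< → cong (_* bin (q + (j ∸ i) ∸ 1) (j ∸ i)) (ind-no (i ≤?_) (λ i≤j → i≰J (≤-trans i≤j (≤-pred j<))))))
                       (sym (cong (_* bin (suc q + (J ∸ i) ∸ 1) (J ∸ i)) (ind-no (i ≤?_) i≰J)))

  -- Multiplication by x/(1-x): shifted prefix sums.
  shift-e : ∀ q i J → S J (e q i) ≡ e (suc q) (suc i) J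
  shift-e q i zero = sym (cong (_* bin (suc q + (0 ∸ suc i) ∸ 1) (0 ∸ suc i)) (ind-no (suc i ≤?_) {0} (λ ())))
  shift-e q i (suc J) = trans (prefix-e q i J) (cong (_* bin (suc q + (J ∸ i) ∸ 1) (J ∸ i)) (sym (ind≤-suc (i ≤? J))))
    where
    ind≤-suc : Dec (i ≤ J) → ind≤ (suc i) (suc J) ≡ ind≤ i J
    ind≤-suc (yes i≤J) = trans (ind-yes (suc i ≤?_) (s≤s i≤J)) (sym (ind-yes (i ≤?_) i≤J))
    ind≤-suc (no i≰J) = trans (ind-no (suc i ≤?_) (i≰J ∘ ≤-pred)) (sym (ind-no (i ≤?_) i≰J))

  S-weighted : ∀ J (f : ℕ → ℕ) → S (suc J) (λ j → j * f (J ∸ j)) ≡ S J (λ u → S (suc u) f)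
  S-weighted J f = trans (S-cong (suc J) (λ j j< → cong (λ z → z * f (J ∸ j)) (sym (m∸[m∸n]≡n (≤-pred j<)))))
      (trans (S-reverse J (λ v → (J ∸ v) * f v)) (reversed J))
    where
    reversed : ∀ J → S (suc J) (λ v → (J ∸ v) * f v) ≡ S J (λ u → S (suc u) f)
    reversed zero = refl
    reversed (suc J) = begin
        S (suc (suc J)) (λ v → (suc J ∸ v) * f v)
      ≡⟨ S-last (suc J) (λ v → (suc J ∸ v) * f v) ⟩
        S (suc J) (λ v → (suc J ∸ v) * f v) + (suc J ∸ suc J) * f (suc J)
      ≡⟨ cong (λ z → S (suc J) (λ v → (suc J ∸ v) * f v) + z * f (suc J)) (n∸n≡0 J) ⟩
        S (suc J) (λ v → (suc J ∸ v) * f v) + 0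
      ≡⟨ +-identityʳ _ ⟩
        S (suc J) (λ v → (suc J ∸ v) * f v)
      ≡⟨ S-cong (suc J) (λ v v< → cong (_* f v) (+-∸-assoc 1 (≤-pred v<))) ⟩
        S (suc J) (λ v → f v + (J ∸ v) * f v)
      ≡⟨ S-+ (suc J) f (λ v → (J ∸ v) * f v) ⟩
        S (suc J) f + S (suc J) (λ v → (J ∸ v) * f v)
      ≡⟨ cong (S (suc J) f +_) (reversed J) ⟩
        S (suc J) f + S J (λ u → S (suc u) f)
      ≡⟨ trans (+-comm (S (suc J) f) _) (sym (S-last J (λ u → S (suc u) f))) ⟩
        S (suc J) (λ u → S (suc u) f) ∎
      where open ≡-Reasoning

  -- One binomial-theorem step: expanding (s + y) · Σ_i C(p,i) s^(p-i) yⁱ,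
  -- where y acts on the coefficient sequence E by shifting.
  binomial-step : ∀ s p (E : ℕ → ℕ) →
    S (suc p) (λ i → bin p i * s ^ (p ∸ i) * (s * E i + E (suc i))) ≡ S (suc (suc p)) (λ i → bin (suc p) i * s ^ (suc p ∸ i) * E i)
  binomial-step s p E = begin
      S (suc p) (λ i → w i * (s * E i + E (suc i)))
    ≡⟨ trans (S-cong (suc p) (λ i _ → *-distribˡ-+ (w i) (s * E i) (E (suc i)))) (S-+ (suc p) (λ i → w i * (s * E i)) (λ i → w i * E (suc i))) ⟩
      S (suc p) (λ i → w i * (s * E i)) + S (suc p) (λ i → w i * E (suc i))
    ≡⟨ cong (_+ S (suc p) (λ i → w i * E (suc i))) sE ⟩
      s ^ suc p * E 0 + S (suc p) (λ i → bin p (suc i) * s ^ (p ∸ i) * E (suc i)) + S (suc p) (λ i → w i * E (suc i))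
    ≡⟨ trans (+-assoc (s ^ suc p * E 0) _ _) (cong (s ^ suc p * E 0 +_) (trans (+-comm (S (suc p) (λ i → bin p (suc i) * s ^ (p ∸ i) * E (suc i))) _) (sym (S-+ (suc p) (λ i → w i * E (suc i)) (λ i → bin p (suc i) * s ^ (p ∸ i) * E (suc i)))))) ⟩
      s ^ suc p * E 0 + S (suc p) (λ i → w i * E (suc i) + bin p (suc i) * s ^ (p ∸ i) * E (suc i))
    ≡⟨ cong₂ _+_ (solve 2 (λ x E → x :* E := con 1 :* x :* E) refl (s ^ suc p) (E 0))
         (S-cong (suc p) (λ i _ → solve 4 (λ a b x E → a :* x :* E :+ b :* x :* E := (a :+ b) :* x :* E) refl (bin p i) (bin p (suc i)) (s ^ (p ∸ i)) (E (suc i)))) ⟩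
      S (suc (suc p)) (λ i → bin (suc p) i * s ^ (suc p ∸ i) * E i) ∎
    where
    open ≡-Reasoning
    w : ℕ → ℕ
    w i = bin p i * s ^ (p ∸ i)
    -- the s-multiplied part, reindexed from i = 1 (the term i = p+1 vanishes)
    sE : S (suc p) (λ i → w i * (s * E i)) ≡ s ^ suc p * E 0 + S (suc p) (λ i → bin p (suc i) * s ^ (p ∸ i) * E (suc i))
    sE = cong₂ _+_ (solve 3 (λ x E s → con 1 :* x :* (s :* E) := s :* x :* E) refl (s ^ p) (E 0) s) (begin
        S p (λ i → bin p (suc i) * s ^ (p ∸ suc i) * (s * E (suc i)))
      ≡⟨ S-cong p (λ i i<p → trans (solve 4 (λ a x s E → a :* x :* (s :* E) := a :* (s :* x) :* E) refl (bin p (suc i)) (s ^ (p ∸ suc i)) s (E (suc i)))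
                                   (cong (λ z → bin p (suc i) * s ^ z * E (suc i)) (sym (+-∸-assoc 1 i<p)))) ⟩
        S p (λ i → bin p (suc i) * s ^ (p ∸ i) * E (suc i))
      ≡⟨ sym (+-identityʳ _) ⟩
        S p (λ i → bin p (suc i) * s ^ (p ∸ i) * E (suc i)) + 0
      ≡⟨ cong (λ z → S p (λ i → bin p (suc i) * s ^ (p ∸ i) * E (suc i)) + z * s ^ (p ∸ p) * E (suc p)) (sym (bin-big p (suc p) (n<1+n p))) ⟩
        S p (λ i → bin p (suc i) * s ^ (p ∸ i) * E (suc i)) + bin p (suc p) * s ^ (p ∸ p) * E (suc p)
      ≡⟨ sym (S-last p (λ i → bin p (suc i) * s ^ (p ∸ i) * E (suc i))) ⟩
        S (suc p) (λ i → bin p (suc i) * s ^ (p ∸ i) * E (suc i)) ∎)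

  module _ (c : ℕ) where

    s : ℕ
    s = suc c

    -- Multiplication by Σ_j (s + j) x^j = s/(1-x) + x/(1-x)² sends
    -- x^i/(1-x)^q to s x^i/(1-x)^(q+1) + x^(i+1)/(1-x)^(q+2).
    convolve-e : ∀ q i J → S (suc J) (λ j₁ → (s + j₁) * e q i (J ∸ j₁)) ≡ s * e (suc q) i J + e (suc (suc q)) (suc i) J
    convolve-e q i J = begin
        S (suc J) (λ j₁ → (s + j₁) * f (J ∸ j₁))
      ≡⟨ S-cong (suc J) (λ j₁ _ → *-distribʳ-+ (f (J ∸ j₁)) s j₁) ⟩
        S (suc J) (λ j₁ → s * f (J ∸ j₁) + j₁ * f (J ∸ j₁))
      ≡⟨ S-+ (suc J) (λ j₁ → s * f (J ∸ j₁)) (λ j₁ → j₁ * f (J ∸ j₁)) ⟩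
        S (suc J) (λ j₁ → s * f (J ∸ j₁)) + S (suc J) (λ j₁ → j₁ * f (J ∸ j₁))
      ≡⟨ cong₂ _+_ (trans (S-*ˡ (suc J) s (λ j₁ → f (J ∸ j₁))) (cong (s *_) (trans (S-reverse J f) (prefix-e q i J))))
                   (S-weighted J f) ⟩
        s * e (suc q) i J + S J (λ u → S (suc u) f)
      ≡⟨ cong (s * e (suc q) i J +_) (trans (S-cong J (λ u _ → prefix-e q i u)) (shift-e (suc q) i J)) ⟩
        s * e (suc q) i J + e (suc (suc q)) (suc i) J ∎
      where
      open ≡-Reasoning
      f = e q i

    -- The closed form of A: (s/(1-x) + x/(1-x)²)^p = Σ_i C(p,i) s^(p-i) xⁱ/(1-x)^(p+i).
    A-closed : ∀ p J → A c p J ≡ S (suc p) (λ i → bin p i * s ^ (p ∸ i) * e (p + i) i J)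
    A-closed zero zero = refl
    A-closed zero (suc J) = sym (trans (+-identityʳ _) (trans (+-identityʳ _) (trans (+-identityʳ _) (bin-big J (suc J) (n<1+n J)))))
    A-closed (suc p) J = begin
        S (suc J) (λ j₁ → (s + j₁) * A c p (J ∸ j₁))
      ≡⟨ S-cong (suc J) (λ j₁ _ → trans (cong ((s + j₁) *_) (A-closed p (J ∸ j₁))) (sym (S-*ˡ (suc p) (s + j₁) (λ i → w i * e (p + i) i (J ∸ j₁))))) ⟩
        S (suc J) (λ j₁ → S (suc p) (λ i → (s + j₁) * (w i * e (p + i) i (J ∸ j₁))))
      ≡⟨ S-swap (suc J) (suc p) (λ j₁ i → (s + j₁) * (w i * e (p + i) i (J ∸ j₁))) ⟩
        S (suc p) (λ i → S (suc J) (λ j₁ → (s + j₁) * (w i * e (p + i) i (J ∸ j₁))))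
      ≡⟨ S-cong (suc p) (λ i _ → perI i) ⟩
        S (suc p) (λ i → w i * (s * E i + E (suc i)))
      ≡⟨ binomial-step s p E ⟩
        S (suc (suc p)) (λ i → bin (suc p) i * s ^ (suc p ∸ i) * e (suc p + i) i J) ∎
      where
      open ≡-Reasoning
      w : ℕ → ℕ
      w i = bin p i * s ^ (p ∸ i)
      E : ℕ → ℕ
      E i = e (suc p + i) i J
      perI : ∀ i → S (suc J) (λ j₁ → (s + j₁) * (w i * e (p + i) i (J ∸ j₁))) ≡ w i * (s * E i + E (suc i))
      perI i = begin
          S (suc J) (λ j₁ → (s + j₁) * (w i * e (p + i) i (J ∸ j₁)))
        ≡⟨ S-cong (suc J) (λ j₁ _ → solve 3 (λ x y z → x :* (y :* z) := y :* (x :* z)) refl (s + j₁) (w i) (e (p + i) i (J ∸ j₁))) ⟩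
          S (suc J) (λ j₁ → w i * ((s + j₁) * e (p + i) i (J ∸ j₁)))
        ≡⟨ S-*ˡ (suc J) (w i) (λ j₁ → (s + j₁) * e (p + i) i (J ∸ j₁)) ⟩
          w i * S (suc J) (λ j₁ → (s + j₁) * e (p + i) i (J ∸ j₁))
        ≡⟨ cong (w i *_) (convolve-e (p + i) i J) ⟩
          w i * (s * E i + e (suc (suc (p + i))) (suc i) J)
        ≡⟨ cong (λ z → w i * (s * E i + e (suc z) (suc i) J)) (sym (+-suc p i)) ⟩
          w i * (s * E i + E (suc i)) ∎

module Assembly where

  open import Data.Nat using (zero; suc; z≤n; s≤s; _⊓_; _≤?_)
  open import Data.Nat.Properties
  open import Data.Nat.DivMod using (m*n/n≡m)
  open import Data.Nat.Solver using (module +-*-Solver)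
  open import Relation.Nullary using (Dec; yes; no)
  open import Relation.Binary.PropositionalEquality
  open import Data.Product using (Σ; _×_; _,_)
  open Counting using (ind-no)
  open Sums
  open InjectiveWords using (FF)
  open Recurrence using (Φ)
  open FinTransfer using (L≡Φ)
  open Unrolling using (A; Φ-unroll; ∸-identity)
  open Binomial using (bin; C≡bin; e; A-closed)
  open +-*-Solver

  FF-fact : ∀ x m → m ≤ x → FF x m * (x ∸ m) ! ≡ x !
  FF-fact x zero _ = +-identityʳ _
  FF-fact (suc x) (suc m) (s≤s m≤x) = trans (*-assoc (suc x) (FF x m) _) (cong (suc x *_) (FF-fact x m m≤x))

  factorial-quotient : ∀ x m → m ≤ x → (x ! / (x ∸ m) !) {{(x ∸ m) !≢0}} ≡ FF x m
  factorial-quotient x m m≤x = trans (cong (λ z → (z / (x ∸ m) !) {{(x ∸ m) !≢0}}) (sym (FF-fact x m m≤x)))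
    (m*n/n≡m (FF x m) ((x ∸ m) !) {{(x ∸ m) !≢0}})

  sumFromTo-S : ∀ a b f → sumFromTo a b f ≡ S (suc b ∸ a) (λ i → f (a + i))
  sumFromTo-S a b f = sum-upTo (λ i → f (a + i)) (suc b ∸ a)

  decompose : ∀ s p r k n → p ≤ r → r ≤ k → s * k ≤ n →
    Σ ℕ λ a → Σ ℕ λ b → Σ ℕ λ N → r ≡ p + a × k ≡ p + a + b × n ≡ s * k + N
  decompose s p r k n p≤r r≤k sk≤n =
    r ∸ p , k ∸ r , n ∸ s * k , sym (m+[n∸m]≡n p≤r) , trans (sym (m+[n∸m]≡n r≤k)) (cong (_+ (k ∸ r)) (sym (m+[n∸m]≡n p≤r))) ,
    sym (m+[n∸m]≡n sk≤n)

  module _ (c p a b N : ℕ) where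
    s = suc c
    r = p + a
    k = p + a + b
    n = s * k + N
    X = c * k + b + N

    Q : ℕ → ℕ → ℕ
    Q i j = ((n ∸ r) ! / (n ∸ r ∸ j ∸ (s ∸ 1) * p) !) {{(n ∸ r ∸ j ∸ (s ∸ 1) * p) !≢0}}
            * (p C i) * ((p + j ∸ 1) C (j ∸ i))
            * L s (r ∸ p) (n ∸ s * p ∸ j) (k ∸ p) * s ^ (p ∸ i)

    Ψ : ℕ → ℕ
    Ψ j = Φ s (s * (a + b) + (N ∸ j)) a (a + b)

    n∸r : n ∸ r ≡ X
    n∸r = ∸-identity {y = r} (solve 5 (λ c p a b N → (con 1 :+ c) :* (p :+ a :+ b) :+ N := (p :+ a) :+ (c :* (p :+ a :+ b) :+ b :+ N)) refl c p a b N)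

    quotient : ∀ j → j ≤ N → ((n ∸ r) ! / (n ∸ r ∸ j ∸ (s ∸ 1) * p) !) {{(n ∸ r ∸ j ∸ (s ∸ 1) * p) !≢0}} ≡ FF X (j + c * p)
    quotient j j≤N = trans (cong (λ y → ((n ∸ r) ! / y !) {{y !≢0}}) (∸-+-assoc (n ∸ r) j (c * p)))
                (trans (factorial-quotient (n ∸ r) (j + c * p) bound) (cong (λ z → FF z (j + c * p)) n∸r))
      where
      bound : j + c * p ≤ n ∸ r
      bound = subst (j + c * p ≤_) (sym n∸r) (subst (_≤ c * k + b + N) (+-comm (c * p) j)
        (+-mono-≤ (≤-trans (*-monoʳ-≤ c (m≤m+n p a)) (≤-trans (*-monoʳ-≤ c (m≤m+n (p + a) b)) (m≤m+n (c * k) b))) j≤N))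

    remainder : ∀ j → j ≤ N → L s (r ∸ p) (n ∸ s * p ∸ j) (k ∸ p) ≡ Ψ j
    remainder j j≤N = begin
        L s (r ∸ p) (n ∸ s * p ∸ j) (k ∸ p)
      ≡⟨ L≡Φ s (r ∸ p) (n ∸ s * p ∸ j) (k ∸ p) (s≤s z≤n) ⟩
        Φ s (n ∸ s * p ∸ j) ((r ∸ p) ⊓ (n ∸ s * p ∸ j)) (k ∸ p)
      ≡⟨ cong₂ (λ u v → Φ s u (v ⊓ u) (k ∸ p)) size (m+n∸m≡n p a) ⟩
        Φ s (s * (a + b) + (N ∸ j)) (a ⊓ (s * (a + b) + (N ∸ j))) (k ∸ p)
      ≡⟨ cong₂ (Φ s (s * (a + b) + (N ∸ j))) (m≤n⇒m⊓n≡m a≤) (trans (cong (_∸ p) (+-assoc p a b)) (m+n∸m≡n p (a + b))) ⟩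
        Ψ j ∎
      where
      open ≡-Reasoning
      size : n ∸ s * p ∸ j ≡ s * (a + b) + (N ∸ j)
      size = trans (cong (λ z → z ∸ s * p ∸ j) (solve 5 (λ s p a b N → s :* (p :+ a :+ b) :+ N := s :* p :+ (s :* (a :+ b) :+ N)) refl s p a b N))
                   (trans (cong (_∸ j) (m+n∸m≡n (s * p) _)) (+-∸-assoc (s * (a + b)) j≤N))
      a≤ : a ≤ s * (a + b) + (N ∸ j)
      a≤ = ≤-trans (m≤m+n a b) (≤-trans (m≤m+n (a + b) (c * (a + b))) (m≤m+n (s * (a + b)) (N ∸ j)))

    summand : ∀ j → j ≤ N → ∀ i → ind≤ i j * Q i j ≡ (FF X (j + c * p) * Ψ j) * (bin p i * s ^ (p ∸ i) * e (p + i) i j)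
    summand j j≤N i = begin
        ind≤ i j * Q i j
      ≡⟨ cong (ind≤ i j *_) (cong₂ (λ u v → u * (p C i) * ((p + j ∸ 1) C (j ∸ i)) * v * s ^ (p ∸ i)) (quotient j j≤N) (remainder j j≤N)) ⟩
        ind≤ i j * (FF X (j + c * p) * (p C i) * ((p + j ∸ 1) C (j ∸ i)) * Ψ j * s ^ (p ∸ i))
      ≡⟨ cong₂ (λ u v → ind≤ i j * (FF X (j + c * p) * u * v * Ψ j * s ^ (p ∸ i))) (C≡bin p i) (C≡bin (p + j ∸ 1) (j ∸ i)) ⟩
        ind≤ i j * (FF X (j + c * p) * bin p i * bin (p + j ∸ 1) (j ∸ i) * Ψ j * s ^ (p ∸ i))
      ≡⟨ solve 6 (λ v f x y φ t → v :* (f :* x :* y :* φ :* t) := (f :* φ) :* (x :* t :* (v :* y))) refl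
           (ind≤ i j) (FF X (j + c * p)) (bin p i) (bin (p + j ∸ 1) (j ∸ i)) (Ψ j) (s ^ (p ∸ i)) ⟩
        (FF X (j + c * p) * Ψ j) * (bin p i * s ^ (p ∸ i) * (ind≤ i j * bin (p + j ∸ 1) (j ∸ i)))
      ≡⟨ cong (λ z → (FF X (j + c * p) * Ψ j) * (bin p i * s ^ (p ∸ i) * z)) (sym (top (i ≤? j))) ⟩
        (FF X (j + c * p) * Ψ j) * (bin p i * s ^ (p ∸ i) * e (p + i) i j) ∎
      where
      open ≡-Reasoning
      top : Dec (i ≤ j) → e (p + i) i j ≡ ind≤ i j * bin (p + j ∸ 1) (j ∸ i)
      top (yes i≤j) = cong (λ z → ind≤ i j * bin (z ∸ 1) (j ∸ i)) (trans (+-assoc p i (j ∸ i)) (cong (p +_) (m+[n∸m]≡n i≤j)))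
      top (no i≰j) rewrite ind-no (i ≤?_) {j} i≰j = refl

    column : ∀ j → j ≤ N → S (suc p) (λ i → ind≤ i j * Q i j) ≡ FF X (j + c * p) * A c p j * Ψ j
    column j j≤N = begin
        S (suc p) (λ i → ind≤ i j * Q i j)
      ≡⟨ S-cong (suc p) (λ i _ → summand j j≤N i) ⟩
        S (suc p) (λ i → (FF X (j + c * p) * Ψ j) * (bin p i * s ^ (p ∸ i) * e (p + i) i j))
      ≡⟨ S-*ˡ (suc p) (FF X (j + c * p) * Ψ j) (λ i → bin p i * s ^ (p ∸ i) * e (p + i) i j) ⟩
        (FF X (j + c * p) * Ψ j) * S (suc p) (λ i → bin p i * s ^ (p ∸ i) * e (p + i) i j)
      ≡⟨ cong ((FF X (j + c * p) * Ψ j) *_) (sym (A-closed c p j)) ⟩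
        (FF X (j + c * p) * Ψ j) * A c p j
      ≡⟨ solve 3 (λ f φ x → (f :* φ) :* x := f :* x :* φ) refl (FF X (j + c * p)) (Ψ j) (A c p j) ⟩
        FF X (j + c * p) * A c p j * Ψ j ∎
      where open ≡-Reasoning

    theorem : L s r n k ≡ sumFromTo 0 p (λ i → sumFromTo i (n ∸ s * k) (λ j → Q i j))
    theorem = begin
        L s r n k
      ≡⟨ L≡Φ s r n k (s≤s z≤n) ⟩
        Φ s n (r ⊓ n) k
      ≡⟨ cong (λ z → Φ s n z k) (m≤n⇒m⊓n≡m (≤-trans (m≤m+n r b) (≤-trans (m≤m+n k (c * k)) (m≤m+n (s * k) N)))) ⟩
        Φ s n r k
      ≡⟨ Φ-unroll c p a b N ⟩
        S (suc N) (λ j → FF X (j + c * p) * A c p j * Ψ j)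
      ≡⟨ sym (S-cong (suc N) (λ j j< → column j (≤-pred j<))) ⟩
        S (suc N) (λ j → S (suc p) (λ i → ind≤ i j * Q i j))
      ≡⟨ sym (S-swap (suc p) (suc N) (λ i j → ind≤ i j * Q i j)) ⟩
        S (suc p) (λ i → S (suc N) (λ j → ind≤ i j * Q i j))
      ≡⟨ sym (S-cong (suc p) (λ i _ → trans (trans (sumFromTo-S i (n ∸ s * k) (Q i)) (cong (λ z → S (suc z ∸ i) (λ j → Q i (i + j))) (m+n∸m≡n (s * k) N)))
                                            (S-from i N (Q i)))) ⟩
        S (suc p) (λ i → sumFromTo i (n ∸ s * k) (Q i))
      ≡⟨ sym (sumFromTo-S 0 p (λ i → sumFromTo i (n ∸ s * k) (Q i))) ⟩
        sumFromTo 0 p (λ i → sumFromTo i (n ∸ s * k) (λ j → Q i j)) ∎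
      where open ≡-Reasoning

open import Data.Nat using (suc)
open import Relation.Binary.PropositionalEquality using (refl)
open import Data.Product using (_,_)

mainTheorem13 : (s p r k n : ℕ) → 1 ≤ s → p ≤ r → r ≤ k → s * k ≤ n →
    L s r n k ≡
      sumFromTo 0 p (λ i → sumFromTo i (n ∸ s * k) (λ j →
        ((n ∸ r) ! / (n ∸ r ∸ j ∸ (s ∸ 1) * p) !) {{(n ∸ r ∸ j ∸ (s ∸ 1) * p) !≢0}}
          * (p C i) * ((p + j ∸ 1) C (j ∸ i))
          * L s (r ∸ p) (n ∸ s * p ∸ j) (k ∸ p) * s ^ (p ∸ i)))
mainTheorem13 (suc c) p r k n _ p≤r r≤k sk≤n with Assembly.decompose (suc c) p r k n p≤r r≤k sk≤n
... | a , b , N , refl , refl , refl = Assembly.theorem c p a b N
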